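{- Let $k\ge1$. The set of $k$-ary trees is in record duality with $\mathcal{PF}_{\le k}$, i.e. $\{\pi_T: T\text{ $k$-ary}\}=\mathcal{PF}_{\le k}$. Consequently $$\sum_{T\text{ $k$-ary}} y^{\mathrm{wait}(T)}z^{\mathrm{psa}(T)}t^{\deg_\circ(T)}w^{\mathrm{chseq}(T)}q^{\mathrm{ord}(T)}=\sum_{\pi\in\mathcal{PF}_{\le k}} y^{\mathrm{probes}(\pi)}z^{\mathrm{lucky}(\pi)}t^{\mathrm{ones}(\pi)}w^{\mathrm{mult}(\pi)}q^{\mathrm{len}(\pi)},$$ with $w^{(b_1,\dots,b_m)}=w_{b_1}\cdots w_{b_m}$.
   Context: Cayley trees: trees on $[n]_0=\{0,\dots,n\}$ ($n\ge0$) rooted at $0$, parent map $f_T$. A $k$-ary tree is a Cayley tree in which every vertex has at most $k$ children. Weary permutation $\omega_T$: priority-first search from $0$ (visit at each step the smallest unvisited vertex adjacent to a visited one); $\omega_T(i)$ = $i$-th non-root vertex visited, $\omega_T(0)=0$. Preference sequence $\pi_T(i)=\omega_T^{ -1}(f_T(i))+1$. $\mathrm{pt}(T)$ is $T$ with each $v$ relabelled $\omega_T^{ -1}(v)$. $\mathrm{ord}(T)=n$; $\deg_\circ(T)$ = number of children of $0$; $\mathrm{chseq}(T)=(\tau_0,\dots,\tau_n)$, $\tau_i$ = number of vertices (root included) with exactly $i$ children; $\mathrm{wait}(T)=\sum_{i=1}^n(i-f_{\mathrm{pt}(T)}(i))$; $\mathrm{psa}(T)=\#\{i: f_{\mathrm{pt}(T)}(i)=i-1\}$.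 Parking function $\pi=(a_1,\dots,a_n)$, $a_i\in[n]$: cars $1,\dots,n$ enter in order a street with spots $1,\dots,n$, car $i$ parks in the first free spot $j\ge a_i$, and all cars park. $\mathcal{PF}_{\le k}$ is the set of parking functions (of any length) in which every symbol appears at most $k$ times. $\mathrm{len}(\pi)=n$; $\mathrm{lucky}(\pi)$ = number of cars parking in their preferred spot; $\mathrm{probes}(\pi)=n+\sum(\text{final spot}-\text{preferred spot})$; $\mathrm{ones}(\pi)=\#\{i:a_i=1\}$; $\mathrm{mult}(\pi)=(\mu_0,\dots,\mu_n)$, $\mu_i$ = number of elements of $[n+1]$ appearing exactly $i$ times. -}

module Defs where

open import Level using (Level)
open import Data.Bool using (Bool; true; false; _∧_; _∨_; not; if_then_else_)
open import Data.Nat using (ℕ; zero; suc; _∸_; _≡ᵇ_; _≤ᵇ_)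
import Data.Nat as N
open import Data.List using (List; []; _∷_; _++_; map; filter; concatMap; upTo; foldr; zip; length)
open import Data.Bool.ListAction using (all; any)
open import Data.Nat.ListAction using (sum)
open import Data.Maybe using (Maybe; just; nothing; is-just; fromMaybe)
open import Data.Product using (_×_; _,_)
open import Data.Vec using (Vec; toList)
import Data.Vec as Vec
open import Algebra.Bundles using (CommutativeSemiring)

countB : {A : Set} → (A → Bool) → List A → ℕ
countB p []       = 0
countB p (x ∷ xs) = if p x then suc (countB p xs) else countB p xs

nthD : List ℕ → ℕ → ℕ
nthD []       _       = 0
nthD (x ∷ xs) zero    = x
nthD (x ∷ xs) (suc i) = nthD xs i

-- position (0-based) of the first occurrence of v, default = length
indexOf : ℕ → List ℕ → ℕ
indexOf v []       = 0
indexOf v (x ∷ xs) = if v ≡ᵇ x then 0 else suc (indexOf v xs)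

memB : ℕ → List ℕ → Bool
memB v xs = any (v ≡ᵇ_) xs

range : ℕ → ℕ → List ℕ
range a b = map (a N.+_) (upTo (suc b ∸ a))

allVecs : (m n : ℕ) → List (Vec ℕ n)
allVecs m zero    = Vec.[] ∷ []
allVecs m (suc n) = concatMap (λ x → map (x Vec.∷_) (allVecs m n)) (upTo m)

-- Cayley trees on [n]_0 = {0,...,n}, rooted at 0.
-- A tree of order n is encoded by its parent map f_T restricted to the
-- non-root vertices 1..n:  T : Vec ℕ n, with  T[i-1] = f_T(i).

-- f_T(v) for v ≥ 1 (and, by convention, 0 ↦ 0)
parent : {n : ℕ} → Vec ℕ n → ℕ → ℕ
parent T zero    = 0
parent T (suc i) = nthD (toList T) i

iter : ℕ → (ℕ → ℕ) → ℕ → ℕ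
iter zero    g x = x
iter (suc m) g x = iter m g (g x)

-- T is a Cayley tree rooted at 0: all parents lie in [n]_0 and every
-- vertex reaches the root 0 by following parents (i.e. no cycles).
isCayleyTree : {n : ℕ} → Vec ℕ n → Bool
isCayleyTree {n} T =
  all (_≤ᵇ n) (toList T) ∧ all (λ v → iter n (parent T) v ≡ᵇ 0) (range 1 n)

children : {n : ℕ} → Vec ℕ n → ℕ → ℕ
children T v = countB (v ≡ᵇ_) (toList T)

isKAry : ℕ → {n : ℕ} → Vec ℕ n → Bool
isKAry k {n} T = all (λ v → children T v ≤ᵇ k) (range 0 n)

kAryTrees : ℕ → (n : ℕ) → List (Vec ℕ n)
kAryTrees k n = filter (λ T → Data.Bool.T? (isCayleyTree T ∧ isKAry k T)) (allVecs (suc n) n)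
  where import Data.Bool

adjB : {n : ℕ} → Vec ℕ n → ℕ → ℕ → Bool
adjB T zero    zero    = false
adjB T zero    (suc j) = parent T (suc j) ≡ᵇ 0
adjB T (suc i) zero    = parent T (suc i) ≡ᵇ 0
adjB T (suc i) (suc j) = (parent T (suc i) ≡ᵇ suc j) ∨ (parent T (suc j) ≡ᵇ suc i)

nextVertex : {n : ℕ} → Vec ℕ n → List ℕ → Maybe ℕ
nextVertex {n} T visited with filter (λ v → Data.Bool.T? (not (memB v visited) ∧ any (adjB T v) visited)) (range 0 n)
  where import Data.Bool
... | []     = nothing
... | v ∷ _  = just v

search : {n : ℕ} → Vec ℕ n → ℕ → List ℕ → List ℕ
search T zero      visited = visited
search T (suc fuel) visited with nextVertex T visited
... | nothing = visited
... | just v  = search T fuel (visited ++ (v ∷ []))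

-- the visiting order [ω_T(0), ω_T(1), ..., ω_T(n)], with ω_T(0) = 0
wearyList : {n : ℕ} → Vec ℕ n → List ℕ
wearyList {n} T = search T n (0 ∷ [])

weary : {n : ℕ} → Vec ℕ n → ℕ → ℕ
weary T i = nthD (wearyList T) i

wearyInv : {n : ℕ} → Vec ℕ n → ℕ → ℕ
wearyInv T v = indexOf v (wearyList T)

prefSeq : {n : ℕ} → Vec ℕ n → Vec ℕ n
prefSeq T = Vec.map (λ p → suc (wearyInv T p)) T

-- parent map of pt(T):  f_{pt(T)}(i) = ω_T^{-1}(f_T(ω_T(i)))
ptParent : {n : ℕ} → Vec ℕ n → ℕ → ℕ
ptParent T i = wearyInv T (parent T (weary T i))

ord : {n : ℕ} → Vec ℕ n → ℕ
ord {n} _ = n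

degRoot : {n : ℕ} → Vec ℕ n → ℕ
degRoot T = children T 0

wait : {n : ℕ} → Vec ℕ n → ℕ
wait {n} T = sum (map (λ i → i ∸ ptParent T i) (range 1 n))

psa : {n : ℕ} → Vec ℕ n → ℕ
psa {n} T = countB (λ i → ptParent T i ≡ᵇ i ∸ 1) (range 1 n)

chseq : {n : ℕ} → Vec ℕ n → List ℕ
chseq {n} T = map (λ i → countB (λ v → children T v ≡ᵇ i) (range 0 n)) (range 0 n)

-- Parking functions of length n: sequences (a_1,...,a_n), a_i ∈ [n],
-- encoded as Vec ℕ n.

findFree : List ℕ → ℕ → ℕ → Maybe ℕ
findFree occ zero     j = nothing
findFree occ (suc fu) j = if memB j occ then findFree occ fu (suc j) else just j

-- park cars in order; returns the final spots (in car order) or nothing if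
-- some car finds no free spot in {a_i, ..., n}
parkFrom : ℕ → List ℕ → List ℕ → Maybe (List ℕ)
parkFrom n occ []       = just occ
parkFrom n occ (a ∷ as) with findFree occ (suc n ∸ a) a
... | nothing = nothing
... | just j  = parkFrom n (occ ++ (j ∷ [])) as

spots : {n : ℕ} → Vec ℕ n → Maybe (List ℕ)
spots {n} π = parkFrom n [] (toList π)

isParkingFunction : {n : ℕ} → Vec ℕ n → Bool
isParkingFunction {n} π =
  all (λ a → (1 ≤ᵇ a) ∧ (a ≤ᵇ n)) (toList π) ∧ is-just (spots π)

occ : {n : ℕ} → Vec ℕ n → ℕ → ℕ
occ π j = countB (j ≡ᵇ_) (toList π)

atMost : ℕ → {n : ℕ} → Vec ℕ n → Bool
atMost k {n} π = all (λ j → occ π j ≤ᵇ k) (range 1 (suc n))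

pfLe : ℕ → (n : ℕ) → List (Vec ℕ n)
pfLe k n = filter (λ π → Data.Bool.T? (isParkingFunction π ∧ atMost k π))
                  (map (Vec.map suc) (allVecs n n))
  where import Data.Bool

len : {n : ℕ} → Vec ℕ n → ℕ
len {n} _ = n

prefSpots : {n : ℕ} → Vec ℕ n → List (ℕ × ℕ)
prefSpots π = zip (toList π) (fromMaybe [] (spots π))

lucky : {n : ℕ} → Vec ℕ n → ℕ
lucky π = countB (λ { (a , s) → a ≡ᵇ s }) (prefSpots π)

probes : {n : ℕ} → Vec ℕ n → ℕ
probes {n} π = n N.+ sum (map (λ { (a , s) → s ∸ a }) (prefSpots π))

ones : {n : ℕ} → Vec ℕ n → ℕ
ones π = countB (_≡ᵇ 1) (toList π)

mult : {n : ℕ} → Vec ℕ n → List ℕ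
mult {n} π = map (λ i → countB (λ j → occ π j ≡ᵇ i) (range 1 (suc n))) (range 0 n)

module Weights {c ℓ : Level} (R : CommutativeSemiring c ℓ) where
  open CommutativeSemiring R
  open import Algebra.Definitions.RawSemiring rawSemiring using (_^_)

  sumR : List Carrier → Carrier
  sumR = foldr _+_ 0#

  prodR : List Carrier → Carrier
  prodR = foldr _*_ 1#

  wpow : (ℕ → Carrier) → List ℕ → Carrier
  wpow w bs = prodR (map w bs)

  treeWeight : (y z t q : Carrier) (w : ℕ → Carrier) {n : ℕ} → Vec ℕ n → Carrier
  treeWeight y z t q w T =
    (y ^ wait T) * (z ^ psa T) * (t ^ degRoot T) * wpow w (chseq T) * (q ^ ord T)

  pfWeight : (y z t q : Carrier) (w : ℕ → Carrier) {n : ℕ} → Vec ℕ n → Carrier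
  pfWeight y z t q w π =
    (y ^ probes π) * (z ^ lucky π) * (t ^ ones π) * wpow w (mult π) * (q ^ len π)

{-# OPTIONS --safe #-}
-- Priority-first search lists the vertices of a tree as 0 = ω(0), ω(1), …, ω(n), every
-- vertex after its parent, and every vertex visited strictly between the parent of v and
-- v is smaller than v.  So when car v, which prefers the spot right after its parent's
-- position, enters the street, the spots between its preference and its own position are
-- already taken by smaller, i.e. earlier, cars: car v parks exactly at the position of v.
-- Conversely the spots of a parking function give back the visiting order and hence the
-- tree.  Along this bijection wait, psa, the root degree and the child counts become
-- probes, lucky cars, ones and symbol multiplicities, and k-arity becomes the bound k on
-- multiplicities.
module Submission where

open import Defs
open import Level using (Level)
open import Algebra.Bundles using (CommutativeSemiring)
open import Data.Bool using (Bool; true; false; T; T?; not; _∧_)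
open import Data.Bool.Properties using (T-∧; T-∨)
open import Data.Bool.ListAction using (all; any)
open import Data.List
  using (List; []; _∷_; _++_; [_]; map; filter; concatMap; upTo; applyUpTo; length; take; zip; head;
         cartesianProductWith)
open import Data.List.Properties
  using (map-id; map-id-local; map-∘; map-cong; map-cong-local; length-map; length-++; length-applyUpTo;
         map-applyUpTo; take-all; ++-assoc; ++-identityʳ; length-filter)
open import Data.List.Membership.Propositional using (_∈_; _∉_; find)
open import Data.List.Membership.Propositional.Properties
  using (∈-map⁺; ∈-map⁻; ∈-++⁺ˡ; ∈-++⁻; ∈-filter⁺; ∈-filter⁻; ∈-upTo⁺; ∈-upTo⁻; ∈-applyUpTo⁺; ∈-applyUpTo⁻;
         ∈-cartesianProductWith⁺; ∈-length)
open import Data.List.Membership.Propositional.Properties.WithK using (unique∧set⇒bag)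
open import Data.List.Relation.Binary.BagAndSetEquality using (∼bag⇒↭)
open import Data.List.Relation.Binary.Permutation.Propositional using (_↭_; ↭⇒↭ₛ′)
open import Data.List.Relation.Binary.Permutation.Propositional.Properties using (↭-length; filter-↭; map⁺)
open import Data.List.Relation.Binary.Subset.Propositional using (_⊆_)
open import Data.List.Relation.Unary.All as All using (All; []; _∷_)
import Data.List.Relation.Unary.All.Properties as AllP
open import Data.List.Relation.Unary.Any as Any using (here; there)
import Data.List.Relation.Unary.Any.Properties as AnyP
open import Data.List.Relation.Unary.Unique.Propositional using (Unique; []; _∷_)
import Data.List.Relation.Unary.Unique.Propositional.Properties as Unique
open import Data.Maybe using (Maybe; just; is-just; fromMaybe)
open import Data.Nat
  using (ℕ; zero; suc; pred; _+_; _∸_; _≤_; _<_; _≡ᵇ_; _≤ᵇ_; z≤n; s≤s; s≤s⁻¹; _≟_; _<?_; ≢-nonZero; >-nonZero)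
open import Data.Nat.Properties
open import Data.Nat.ListAction using (sum)
open import Data.Nat.ListAction.Properties using (sum-↭)
open import Data.List.Membership.DecPropositional _≟_ using (_∈?_)
open import Data.Product using (Σ; ∃-syntax; _×_; _,_; proj₁; proj₂)
open import Data.Sum using (inj₁; inj₂)
open import Data.Vec using (Vec; toList)
import Data.Vec as Vec
import Data.Vec.Properties as Vec
open import Function using (_∘_; id; _⇔_; mk⇔; Equivalence)
open import Relation.Binary.PropositionalEquality
  using (_≡_; _≢_; refl; sym; trans; cong; cong₂; subst; subst₂; module ≡-Reasoning)
open import Relation.Nullary using (¬_; yes; no; contradiction)
open import Relation.Nullary.Reflects using (Reflects; ofʸ; ofⁿ; fromEquivalence)

≡ᵇ-reflects : ∀ m n → Reflects (m ≡ n) (m ≡ᵇ n)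
≡ᵇ-reflects m n = fromEquivalence (≡ᵇ⇒≡ m n) (≡⇒≡ᵇ m n)

memB-reflects : ∀ v xs → Reflects (v ∈ xs) (memB v xs)
memB-reflects v xs = fromEquivalence
  (Any.map (λ {x} → ≡ᵇ⇒≡ v x) ∘ AnyP.any⁻ (v ≡ᵇ_) xs)
  (AnyP.any⁺ (v ≡ᵇ_) ∘ Any.map (λ {x} → ≡⇒≡ᵇ v x))

T-all⇔ : ∀ {A : Set} (p : A → Bool) xs → T (all p xs) ⇔ (∀ {x} → x ∈ xs → T (p x))
T-all⇔ p xs = mk⇔ (All.lookup ∘ AllP.all⁺ p xs) (AllP.all⁻ p ∘ All.tabulate)

countB≡length-filter : ∀ {A : Set} (p : A → Bool) xs → countB p xs ≡ length (filter (T? ∘ p) xs)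
countB≡length-filter p []       = refl
countB≡length-filter p (x ∷ xs) with p x
... | true  = cong suc (countB≡length-filter p xs)
... | false = countB≡length-filter p xs

countB-↭ : ∀ {A : Set} (p : A → Bool) {xs ys} → xs ↭ ys → countB p xs ≡ countB p ys
countB-↭ p {xs} {ys} xs↭ys = begin
  countB p xs                    ≡⟨ countB≡length-filter p xs ⟩
  length (filter (T? ∘ p) xs)    ≡⟨ ↭-length (filter-↭ (T? ∘ p) xs↭ys) ⟩
  length (filter (T? ∘ p) ys)    ≡⟨ countB≡length-filter p ys ⟨
  countB p ys                    ∎
  where open ≡-Reasoning

countB-map : ∀ {A B : Set} (p : B → Bool) (f : A → B) xs → countB p (map f xs) ≡ countB (p ∘ f) xs
countB-map p f []       = refl
countB-map p f (x ∷ xs) with p (f x)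
... | true  = cong suc (countB-map p f xs)
... | false = countB-map p f xs

countB-cong : ∀ {A : Set} {p q : A → Bool} xs → (∀ {x} → x ∈ xs → p x ≡ q x) → countB p xs ≡ countB q xs
countB-cong []       p≗q = refl
countB-cong {q = q} (x ∷ xs) p≗q rewrite p≗q (here refl) with q x
... | true  = cong suc (countB-cong xs (p≗q ∘ there))
... | false = countB-cong xs (p≗q ∘ there)

∈-range⁺ : ∀ {a b x} → a ≤ x → x ≤ b → x ∈ range a b
∈-range⁺ {a} {b} {x} a≤x x≤b = subst (_∈ range a b) (m+[n∸m]≡n a≤x) (∈-map⁺ (a +_) (∈-upTo⁺ x∸a<))
  where
  x∸a< : x ∸ a < suc b ∸ a
  x∸a< = subst (x ∸ a <_) (sym (+-∸-assoc 1 (≤-trans a≤x x≤b))) (s≤s (∸-monoˡ-≤ a x≤b))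

∈-range⁻ : ∀ a b {x} → x ∈ range a b → a ≤ x × x ≤ b
∈-range⁻ a b x∈ with ∈-map⁻ (a +_) x∈
... | i , i∈ , refl = m≤m+n a i , a+i≤b
  where
  a+i≤b : a + i ≤ b
  a+i≤b with a ≤? b
  ... | yes a≤b = subst (a + i ≤_) (m+[n∸m]≡n a≤b)
                    (+-monoʳ-≤ a (<⇒≤pred (subst (i <_) (+-∸-assoc 1 a≤b) (∈-upTo⁻ i∈))))
  ... | no a≰b = contradiction (subst (i <_) (m≤n⇒m∸n≡0 (≰⇒> a≰b)) (∈-upTo⁻ i∈)) n≮0

length-range : ∀ a b → length (range a b) ≡ suc b ∸ a
length-range a b = trans (length-map (a +_) (upTo (suc b ∸ a))) (length-applyUpTo id (suc b ∸ a))

range-unique : ∀ a b → Unique (range a b)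
range-unique a b = Unique.map⁺ (+-cancelˡ-≡ a _ _) (Unique.upTo⁺ (suc b ∸ a))

range0≡upTo : ∀ n → range 0 n ≡ upTo (suc n)
range0≡upTo n = map-id (upTo (suc n))

indexOf-∉ : ∀ {v} xs → v ∉ xs → indexOf v xs ≡ length xs
indexOf-∉     []       v∉ = refl
indexOf-∉ {v} (x ∷ xs) v∉ with v ≡ᵇ x | ≡ᵇ-reflects v x
... | true  | ofʸ refl = contradiction (here refl) v∉
... | false | ofⁿ _    = cong suc (indexOf-∉ xs (v∉ ∘ there))

indexOf<length : ∀ {v} xs → v ∈ xs → indexOf v xs < length xs
indexOf<length {v} (x ∷ xs) v∈ with v ≡ᵇ x | ≡ᵇ-reflects v x | v∈
... | true  | _       | _         = s≤s z≤n
... | false | ofⁿ v≢x | here v≡x  = contradiction v≡x v≢x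
... | false | _       | there v∈′ = s≤s (indexOf<length xs v∈′)

indexOf<length⇒∈ : ∀ {v} xs → indexOf v xs < length xs → v ∈ xs
indexOf<length⇒∈ {v} xs lt with v ∈? xs
... | yes v∈ = v∈
... | no v∉  = contradiction (indexOf-∉ xs v∉) (<⇒≢ lt)

nthD-indexOf : ∀ {v} xs → v ∈ xs → nthD xs (indexOf v xs) ≡ v
nthD-indexOf {v} (x ∷ xs) v∈ with v ≡ᵇ x | ≡ᵇ-reflects v x | v∈
... | true  | ofʸ v≡x | _         = sym v≡x
... | false | ofⁿ v≢x | here v≡x  = contradiction v≡x v≢x
... | false | _       | there v∈′ = nthD-indexOf xs v∈′

nthD∈ : ∀ xs {i} → i < length xs → nthD xs i ∈ xs
nthD∈ (x ∷ xs) {zero}  _          = here refl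
nthD∈ (x ∷ xs) {suc i} (s≤s i<∣xs∣) = there (nthD∈ xs i<∣xs∣)

indexOf-nthD : ∀ xs {i} → Unique xs → i < length xs → indexOf (nthD xs i) xs ≡ i
indexOf-nthD (x ∷ xs) {zero}  _           _          with x ≡ᵇ x | ≡ᵇ-reflects x x
... | true  | _        = refl
... | false | ofⁿ x≢x = contradiction refl x≢x
indexOf-nthD (x ∷ xs) {suc i} (x∉ ∷ uxs) (s≤s i<∣xs∣) with nthD xs i ≡ᵇ x | ≡ᵇ-reflects (nthD xs i) x
... | true  | ofʸ xᵢ≡x = contradiction (sym xᵢ≡x) (All.lookup x∉ (nthD∈ xs i<∣xs∣))
... | false | _         = cong suc (indexOf-nthD xs uxs i<∣xs∣)

∈-take⇒indexOf< : ∀ {v} k xs → v ∈ take k xs → indexOf v xs < k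
∈-take⇒indexOf< {v} (suc k) (x ∷ xs) v∈ with v ≡ᵇ x | ≡ᵇ-reflects v x | v∈
... | true  | _       | _         = s≤s z≤n
... | false | ofⁿ v≢x | here v≡x  = contradiction v≡x v≢x
... | false | _       | there v∈′ = s≤s (∈-take⇒indexOf< k xs v∈′)

indexOf<⇒∈-take : ∀ {v} k xs → v ∈ xs → indexOf v xs < k → v ∈ take k xs
indexOf<⇒∈-take {v} (suc k) (x ∷ xs) v∈ lt with v ≡ᵇ x | ≡ᵇ-reflects v x | v∈
... | true  | ofʸ v≡x | _         = here v≡x
... | false | ofⁿ v≢x | here v≡x  = contradiction v≡x v≢x
... | false | _       | there v∈′ = there (indexOf<⇒∈-take k xs v∈′ (s≤s⁻¹ lt))

∈-take : ∀ {v : ℕ} k xs → v ∈ take k xs → v ∈ xs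
∈-take (suc k) (x ∷ xs) (here v≡x)  = here v≡x
∈-take (suc k) (x ∷ xs) (there v∈) = there (∈-take k xs v∈)

take-suc-nthD : ∀ k xs → k < length xs → take (suc k) xs ≡ take k xs ++ [ nthD xs k ]
take-suc-nthD zero    (x ∷ xs) _               = refl
take-suc-nthD (suc k) (x ∷ xs) (s≤s k<∣xs∣) = cong (x ∷_) (take-suc-nthD k xs k<∣xs∣)

indexOf-++ˡ : ∀ {v} xs ys → v ∈ xs → indexOf v (xs ++ ys) ≡ indexOf v xs
indexOf-++ˡ {v} (x ∷ xs) ys v∈ with v ≡ᵇ x | ≡ᵇ-reflects v x | v∈
... | true  | _       | _         = refl
... | false | ofⁿ v≢x | here v≡x  = contradiction v≡x v≢x
... | false | _       | there v∈′ = cong suc (indexOf-++ˡ xs ys v∈′)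

indexOf-++ʳ : ∀ {v} xs ys → v ∉ xs → indexOf v (xs ++ ys) ≡ length xs + indexOf v ys
indexOf-++ʳ     []       ys v∉ = refl
indexOf-++ʳ {v} (x ∷ xs) ys v∉ with v ≡ᵇ x | ≡ᵇ-reflects v x
... | true  | ofʸ v≡x = contradiction (here v≡x) v∉
... | false | _       = cong suc (indexOf-++ʳ xs ys (v∉ ∘ there))

indexOf-snoc-new : ∀ {w} xs → w ∉ xs → indexOf w (xs ++ [ w ]) ≡ length xs
indexOf-snoc-new {w} xs w∉ with w ≡ᵇ w | ≡ᵇ-reflects w w | indexOf-++ʳ xs [ w ] w∉
... | true  | _        | eq = trans eq (+-identityʳ _)
... | false | ofⁿ w≢w | _  = contradiction refl w≢w

indexOf≤indexOf-++ : ∀ {v} xs ys → indexOf v xs ≤ indexOf v (xs ++ ys)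
indexOf≤indexOf-++ {v} xs ys with v ∈? xs
... | yes v∈ = ≤-reflexive (sym (indexOf-++ˡ xs ys v∈))
... | no  v∉ = subst₂ _≤_ (sym (indexOf-∉ xs v∉)) (sym (indexOf-++ʳ xs ys v∉)) (m≤m+n _ _)

indexOf-++<length⇒∈ : ∀ {v} xs ys → indexOf v (xs ++ ys) < length xs → v ∈ xs
indexOf-++<length⇒∈ {v} xs ys lt with v ∈? xs
... | yes v∈ = v∈
... | no  v∉ = contradiction (subst (_< length xs) (indexOf-++ʳ xs ys v∉) lt) (m+n≮m (length xs) _)

nthD-++ˡ : ∀ xs ys {j} → j < length xs → nthD (xs ++ ys) j ≡ nthD xs j
nthD-++ˡ (x ∷ xs) ys {zero}  _               = refl
nthD-++ˡ (x ∷ xs) ys {suc j} (s≤s j<∣xs∣) = nthD-++ˡ xs ys j<∣xs∣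

nthD-++-length : ∀ xs {y ys} → nthD (xs ++ y ∷ ys) (length xs) ≡ y
nthD-++-length []       = refl
nthD-++-length (x ∷ xs) = nthD-++-length xs

nthD-map : ∀ (f : ℕ → ℕ) xs {i} → i < length xs → nthD (map f xs) i ≡ f (nthD xs i)
nthD-map f (x ∷ xs) {zero}  _               = refl
nthD-map f (x ∷ xs) {suc i} (s≤s i<∣xs∣) = nthD-map f xs i<∣xs∣

nthD-applyUpTo : ∀ (g : ℕ → ℕ) m {i} → i < m → nthD (applyUpTo g m) i ≡ g i
nthD-applyUpTo g (suc m) {zero}  _         = refl
nthD-applyUpTo g (suc m) {suc i} (s≤s i<m) = nthD-applyUpTo (g ∘ suc) m i<m

applyUpTo-nthD : ∀ xs → applyUpTo (nthD xs) (length xs) ≡ xs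
applyUpTo-nthD []       = refl
applyUpTo-nthD (x ∷ xs) = cong (x ∷_) (applyUpTo-nthD xs)

take-applyUpTo : ∀ {A : Set} (g : ℕ → A) m {i} → i ≤ m → take i (applyUpTo g m) ≡ applyUpTo g i
take-applyUpTo g m       {zero}  _         = refl
take-applyUpTo g (suc m) {suc i} (s≤s i≤m) = cong (g 0 ∷_) (take-applyUpTo (g ∘ suc) m i≤m)

zip-applyUpTo : ∀ {A B : Set} (f : ℕ → A) (g : ℕ → B) m →
                zip (applyUpTo f m) (applyUpTo g m) ≡ applyUpTo (λ i → f i , g i) m
zip-applyUpTo f g zero    = refl
zip-applyUpTo f g (suc m) = cong ((f 0 , g 0) ∷_) (zip-applyUpTo (f ∘ suc) (g ∘ suc) m)

≡ᵇ-cong : ∀ {a b c d} → (a ≡ b ⇔ c ≡ d) → (a ≡ᵇ b) ≡ (c ≡ᵇ d)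
≡ᵇ-cong {a} {b} {c} {d} a≡b⇔c≡d with a ≡ᵇ b | ≡ᵇ-reflects a b | c ≡ᵇ d | ≡ᵇ-reflects c d
... | true  | _        | true  | _        = refl
... | false | _        | false | _        = refl
... | true  | ofʸ a≡b | false | ofⁿ c≢d = contradiction (Equivalence.to a≡b⇔c≡d a≡b) c≢d
... | false | ofⁿ a≢b | true  | ofʸ c≡d = contradiction (Equivalence.from a≡b⇔c≡d c≡d) a≢b

sum-map-suc : ∀ {A : Set} (f : A → ℕ) xs → sum (map (suc ∘ f) xs) ≡ length xs + sum (map f xs)
sum-map-suc f []       = refl
sum-map-suc f (x ∷ xs) = cong suc (begin
  f x + sum (map (suc ∘ f) xs)       ≡⟨ cong (f x +_) (sum-map-suc f xs) ⟩
  f x + (length xs + sum (map f xs)) ≡⟨ +-assoc (f x) _ _ ⟨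
  f x + length xs + sum (map f xs)   ≡⟨ cong (_+ sum (map f xs)) (+-comm (f x) (length xs)) ⟩
  length xs + f x + sum (map f xs)   ≡⟨ +-assoc (length xs) _ _ ⟩
  length xs + (f x + sum (map f xs)) ∎)
  where open ≡-Reasoning

Vec-map-id-local : ∀ {A : Set} {f : A → A} {n} (xs : Vec A n) →
                   (∀ {x} → x ∈ toList xs → f x ≡ x) → Vec.map f xs ≡ xs
Vec-map-id-local Vec.[]        _    = refl
Vec-map-id-local (x Vec.∷ xs) fx≡x = cong₂ Vec._∷_ (fx≡x (here refl)) (Vec-map-id-local xs (fx≡x ∘ there))

toList-parent : ∀ {n} (τ : Vec ℕ n) → toList τ ≡ applyUpTo (parent τ ∘ suc) n
toList-parent τ = trans (sym (applyUpTo-nthD (toList τ))) (cong (applyUpTo (nthD (toList τ))) (Vec.length-toList τ))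

Unique-⇔⇒↭ : ∀ {A : Set} {xs ys : List A} →
             Unique xs → Unique ys → (∀ {z} → z ∈ xs ⇔ z ∈ ys) → xs ↭ ys
Unique-⇔⇒↭ uxs uys xs≈ys = ∼bag⇒↭ (unique∧set⇒bag uxs uys xs≈ys)

Unique-⊆⇒length≤ : ∀ {xs ys : List ℕ} → Unique xs → Unique ys → xs ⊆ ys → length xs ≤ length ys
Unique-⊆⇒length≤ {xs} {ys} uxs uys xs⊆ys = begin
  length xs                   ≡⟨ ↭-length (Unique-⇔⇒↭ uxs (Unique.filter⁺ (_∈? xs) uys) (mk⇔ to from)) ⟩
  length (filter (_∈? xs) ys) ≤⟨ length-filter (_∈? xs) ys ⟩
  length ys                   ∎
  where
  open ≤-Reasoning
  to : ∀ {z} → z ∈ xs → z ∈ filter (_∈? xs) ys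
  to z∈ = ∈-filter⁺ (_∈? xs) (xs⊆ys z∈) z∈
  from : ∀ {z} → z ∈ filter (_∈? xs) ys → z ∈ xs
  from z∈ = proj₂ (∈-filter⁻ (_∈? xs) {xs = ys} z∈)

Unique-⊆-length≥⇒⊇ : ∀ {xs ys : List ℕ} →
                     Unique xs → Unique ys → xs ⊆ ys → length ys ≤ length xs → ys ⊆ xs
Unique-⊆-length≥⇒⊇ {xs} {ys} uxs uys xs⊆ys ∣ys∣≤∣xs∣ {y} y∈ys with y ∈? xs
... | yes y∈xs = y∈xs
... | no  y∉xs = contradiction ∣ys∣≤∣xs∣ (<⇒≱ (Unique-⊆⇒length≤ (y∉ ∷ uxs) uys y∷xs⊆ys))
  where
  y∉ : All (y ≢_) xs
  y∉ = All.tabulate (λ z∈ y≡z → y∉xs (subst (_∈ xs) (sym y≡z) z∈))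
  y∷xs⊆ys : y ∷ xs ⊆ ys
  y∷xs⊆ys (here refl) = y∈ys
  y∷xs⊆ys (there z∈)  = xs⊆ys z∈

Unique-map : ∀ {f : ℕ → ℕ} xs → Unique xs →
             (∀ {x y} → x ∈ xs → y ∈ xs → f x ≡ f y → x ≡ y) → Unique (map f xs)
Unique-map []       []          _   = []
Unique-map (x ∷ xs) (x∉ ∷ uxs) inj =
  AllP.map⁺ (All.tabulate (λ y∈ fx≡fy → All.lookup x∉ y∈ (inj (here refl) (there y∈) fx≡fy)))
  ∷ Unique-map xs uxs (λ x∈ y∈ → inj (there x∈) (there y∈))

map-↭-self : ∀ {f : ℕ → ℕ} {xs} → Unique xs → (∀ {x y} → x ∈ xs → y ∈ xs → f x ≡ f y → x ≡ y) →
             (∀ {x} → x ∈ xs → f x ∈ xs) → map f xs ↭ xs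
map-↭-self {f} {xs} uxs inj into =
  Unique-⇔⇒↭ uniq uxs (mk⇔ to (Unique-⊆-length≥⇒⊇ uniq uxs to (≤-reflexive (sym (length-map f xs)))))
  where
  uniq : Unique (map f xs)
  uniq = Unique-map xs uxs inj
  to : map f xs ⊆ xs
  to z∈ with ∈-map⁻ f z∈
  ... | x , x∈ , refl = into x∈

head-filter-applyUpTo⁻ : ∀ (P : ℕ → Bool) g m {v} → head (filter (T? ∘ P) (applyUpTo g m)) ≡ just v →
                         ∃[ i ] (i < m × v ≡ g i × T (P v) × (∀ {j} → j < i → ¬ T (P (g j))))
head-filter-applyUpTo⁻ P g (suc m) eq with P (g 0) in P₀
... | true  with refl ← eq = 0 , s≤s z≤n , refl , subst T (sym P₀) _ , λ ()
... | false with head-filter-applyUpTo⁻ P (g ∘ suc) m eq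
...   | i , i<m , refl , Pv , least =
  suc i , s≤s i<m , refl , Pv , λ { {zero} _ → subst T P₀ ; {suc j} (s≤s j<i) → least j<i }

head-filter-applyUpTo⁺ : ∀ (P : ℕ → Bool) g m {i} → i < m → T (P (g i)) → (∀ {j} → j < i → ¬ T (P (g j))) →
                         head (filter (T? ∘ P) (applyUpTo g m)) ≡ just (g i)
head-filter-applyUpTo⁺ P g (suc m) {zero}  _         Pgi _ with P (g 0) | Pgi
... | true | _ = refl
head-filter-applyUpTo⁺ P g (suc m) {suc i} (s≤s i<m) Pgi least with P (g 0) | least {0} (s≤s z≤n)
... | true  | ¬P₀ = contradiction _ ¬P₀
... | false | _   = head-filter-applyUpTo⁺ P (g ∘ suc) m i<m Pgi (least ∘ s≤s)

m+1+k≡1+n⇒m≤n : ∀ {m k n} → m + suc k ≡ suc n → m ≤ n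
m+1+k≡1+n⇒m≤n {m} eq = s≤s⁻¹ (subst (m <_) eq (m<m+n m (s≤s z≤n)))

head-just : ∀ {A : Set} {x : A} {xs} → x ∈ xs → ∃[ y ] head xs ≡ just y
head-just {xs = y ∷ _} _ = y , refl

-- Trees and priority-first search

record IsTree {n : ℕ} (τ : Vec ℕ n) : Set where
  field
    label≤ : ∀ {x} → x ∈ toList τ → x ≤ n
    reachesRoot : ∀ {v} → 1 ≤ v → v ≤ n → iter n (parent τ) v ≡ 0

isCayleyTree⇔IsTree : ∀ {n} (τ : Vec ℕ n) → T (isCayleyTree τ) ⇔ IsTree τ
isCayleyTree⇔IsTree {n} τ = mk⇔ to from
  where
  to : T (isCayleyTree τ) → IsTree τ
  to h = let labels , roots = Equivalence.to T-∧ h in record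
    { label≤      = λ x∈ → ≤ᵇ⇒≤ _ n (Equivalence.to (T-all⇔ _ (toList τ)) labels x∈)
    ; reachesRoot = λ 1≤v v≤n → ≡ᵇ⇒≡ _ 0 (Equivalence.to (T-all⇔ _ (range 1 n)) roots (∈-range⁺ 1≤v v≤n))
    }
  from : IsTree τ → T (isCayleyTree τ)
  from tree = Equivalence.from T-∧
    ( Equivalence.from (T-all⇔ _ (toList τ)) (≤⇒≤ᵇ ∘ label≤)
    , Equivalence.from (T-all⇔ _ (range 1 n)) λ v∈ → let 1≤v , v≤n = ∈-range⁻ 1 n v∈ in
                                                     ≡⇒≡ᵇ _ 0 (reachesRoot 1≤v v≤n))
    where open IsTree tree

parent≤ : ∀ {n} {τ : Vec ℕ n} → IsTree τ → ∀ v → parent τ v ≤ n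
parent≤ tree zero    = z≤n
parent≤ {τ = τ} tree (suc i) = nthD-bound (toList τ) i (IsTree.label≤ tree)
  where
  nthD-bound : ∀ {n} xs i → (∀ {x} → x ∈ xs → x ≤ n) → nthD xs i ≤ n
  nthD-bound []       i       _   = z≤n
  nthD-bound (x ∷ xs) zero    xs≤ = xs≤ (here refl)
  nthD-bound (x ∷ xs) (suc i) xs≤ = nthD-bound xs i (xs≤ ∘ there)

module PrioritySearch {n : ℕ} (τ : Vec ℕ n) where

  Available : List ℕ → ℕ → Set
  Available vis v = v ∉ vis × parent τ v ∈ vis

  LeastAvailable : List ℕ → ℕ → Set
  LeastAvailable vis w = w ≤ n × Available vis w × (∀ {u} → u < w → ¬ Available vis u)

  ParentClosed : List ℕ → Set
  ParentClosed vis = ∀ {x} → x ∈ vis → parent τ x ∈ vis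

  availB : List ℕ → ℕ → Bool
  availB vis v = not (memB v vis) ∧ any (adjB τ v) vis

  nextVertex≡head : ∀ vis → nextVertex τ vis ≡ head (filter (T? ∘ availB vis) (upTo (suc n)))
  nextVertex≡head vis = trans nextVertex≡ (cong (head ∘ filter (T? ∘ availB vis)) (range0≡upTo n))
    where
    nextVertex≡ : nextVertex τ vis ≡ head (filter (T? ∘ availB vis) (range 0 n))
    nextVertex≡ with filter (λ v → T? (not (memB v vis) ∧ any (adjB τ v) vis)) (range 0 n)
    ... | []    = refl
    ... | _ ∷ _ = refl

  T-not-memB : ∀ {v xs} → T (not (memB v xs)) ⇔ v ∉ xs
  T-not-memB {v} {xs} with memB v xs | memB-reflects v xs
  ... | true  | ofʸ v∈ = mk⇔ (λ ()) (λ v∉ → v∉ v∈)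
  ... | false | ofⁿ v∉ = mk⇔ (λ _ → v∉) _

  adjB-parent : ∀ v → v ≢ 0 → T (adjB τ v (parent τ v))
  adjB-parent zero    v≢0 = contradiction refl v≢0
  adjB-parent (suc i) _   = adjacent (parent τ (suc i)) refl
    where
    adjacent : ∀ x → parent τ (suc i) ≡ x → T (adjB τ (suc i) x)
    adjacent zero    eq = ≡⇒≡ᵇ _ 0 eq
    adjacent (suc j) eq = Equivalence.from T-∨ (inj₁ (≡⇒≡ᵇ _ (suc j) eq))

  -- Once the visited set contains the root and is closed under parents, the only
  -- visited neighbour an unvisited vertex can have is its parent.
  availB⇔Available : ∀ {vis} → 0 ∈ vis → ParentClosed vis → ∀ v → T (availB vis v) ⇔ Available vis v
  availB⇔Available {vis} root∈ closed v = mk⇔ to from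
    where
    parent∈ : ∀ {v x} → v ∉ vis → x ∈ vis → T (adjB τ v x) → parent τ v ∈ vis
    parent∈ {zero}          v∉ _  _   = contradiction root∈ v∉
    parent∈ {suc i} {zero}  v∉ x∈ adj = subst (_∈ vis) (sym (≡ᵇ⇒≡ _ 0 adj)) x∈
    parent∈ {suc i} {suc j} v∉ x∈ adj with Equivalence.to T-∨ adj
    ... | inj₁ e = subst (_∈ vis) (sym (≡ᵇ⇒≡ _ (suc j) e)) x∈
    ... | inj₂ e = contradiction (subst (_∈ vis) (≡ᵇ⇒≡ _ (suc i) e) (closed x∈)) v∉
    to : T (availB vis v) → Available vis v
    to h with Equivalence.to T-∧ h
    ... | unvisited , adjacent with find (AnyP.any⁻ (adjB τ v) vis adjacent)
    ...   | x , x∈ , adj = v∉ , parent∈ v∉ x∈ adj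
      where
      v∉ : v ∉ vis
      v∉ = Equivalence.to (T-not-memB {v}) unvisited
    from : Available vis v → T (availB vis v)
    from (v∉ , p∈) = Equivalence.from T-∧
      ( Equivalence.from T-not-memB v∉
      , AnyP.any⁺ (adjB τ v) (Any.map (λ { refl → adjB-parent v (λ { refl → v∉ root∈ }) }) p∈))

  nextVertex⇒least : ∀ {vis w} → 0 ∈ vis → ParentClosed vis → nextVertex τ vis ≡ just w → LeastAvailable vis w
  nextVertex⇒least {vis} root∈ closed eq
    with head-filter-applyUpTo⁻ (availB vis) id (suc n) (trans (sym (nextVertex≡head vis)) eq)
  ... | _ , w<1+n , refl , avail , least =
    s≤s⁻¹ w<1+n , Equivalence.to (≡avail _) avail , λ u<w → least u<w ∘ Equivalence.from (≡avail _)
    where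
    ≡avail : ∀ v → T (availB vis v) ⇔ Available vis v
    ≡avail = availB⇔Available root∈ closed

  least⇒nextVertex : ∀ {vis w} → 0 ∈ vis → ParentClosed vis → LeastAvailable vis w → nextVertex τ vis ≡ just w
  least⇒nextVertex {vis} root∈ closed (w≤n , avail , least) = trans (nextVertex≡head vis)
    (head-filter-applyUpTo⁺ (availB vis) id (suc n) (s≤s w≤n) (Equivalence.from (≡avail _) avail)
                            (λ u<w → least u<w ∘ Equivalence.to (≡avail _)))
    where
    ≡avail : ∀ v → T (availB vis v) ⇔ Available vis v
    ≡avail = availB⇔Available root∈ closed

  available⇒nextVertex : ∀ {vis u} → 0 ∈ vis → ParentClosed vis → u ≤ n → Available vis u →
                         ∃[ w ] nextVertex τ vis ≡ just w
  available⇒nextVertex {vis} root∈ closed u≤n avail rewrite nextVertex≡head vis =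
    head-just (∈-filter⁺ (T? ∘ availB vis) (∈-upTo⁺ (s≤s u≤n))
                         (Equivalence.from (availB⇔Available root∈ closed _) avail))

  -- indexOf v vis is length vis for unvisited v, so greedy says: every vertex
  -- visited after the parent of v, and before v or so far, is smaller than v.
  record SearchPrefix (vis : List ℕ) : Set where
    field
      root-first   : nthD vis 0 ≡ 0
      root∈        : 0 ∈ vis
      unique       : Unique vis
      bounded      : ∀ {x} → x ∈ vis → x ≤ n
      parent-first : ∀ {x} → x ∈ vis → x ≢ 0 → indexOf (parent τ x) vis < indexOf x vis
      greedy       : ∀ {v j} → v ≢ 0 → v ≤ n → j < length vis →
                     indexOf (parent τ v) vis < j → j < indexOf v vis → nthD vis j < v

    parentClosed : ParentClosed vis
    parentClosed {zero}  _  = root∈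
    parentClosed {suc x} x∈ = indexOf<length⇒∈ vis (<-trans (parent-first x∈ λ ()) (indexOf<length vis x∈))

  root-prefix : SearchPrefix [ 0 ]
  root-prefix = record
    { root-first   = refl
    ; root∈        = here refl
    ; unique       = [] ∷ []
    ; bounded      = λ { (here refl) → z≤n }
    ; parent-first = λ { (here refl) 0≢0 → contradiction refl 0≢0 }
    ; greedy       = λ { {j = zero} _ _ _ () _ ; {j = suc j} _ _ (s≤s ()) _ _ }
    }

  greedy-snoc : ∀ {vis w} → SearchPrefix vis → LeastAvailable vis w →
                ∀ {v j} → v ≢ 0 → v ≤ n → j < length (vis ++ [ w ]) →
                indexOf (parent τ v) (vis ++ [ w ]) < j → j < indexOf v (vis ++ [ w ]) → nthD (vis ++ [ w ]) j < v
  greedy-snoc {vis} {w} sp (_ , (w∉ , _) , least) {v} {j} v≢0 v≤n j<∣vis′∣ pv<j j<v with j <? length vis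
  ... | yes j<∣vis∣ = subst (_< v) (sym (nthD-++ˡ vis [ w ] j<∣vis∣))
                        (greedy v≢0 v≤n j<∣vis∣ (≤-<-trans (indexOf≤indexOf-++ vis [ w ]) pv<j) j<indexOf-v)
    where
    open SearchPrefix sp
    j<indexOf-v : j < indexOf v vis
    j<indexOf-v with v ∈? vis
    ... | yes v∈ = subst (j <_) (indexOf-++ˡ vis [ w ] v∈) j<v
    ... | no  v∉ = subst (j <_) (sym (indexOf-∉ vis v∉)) j<∣vis∣
  ... | no j≮∣vis∣ = subst (_< v) (sym (trans (cong (nthD (vis ++ [ w ])) j≡) (nthD-++-length vis))) w<v
    where
    j≡ : j ≡ length vis
    j≡ = ≤-antisym (s≤s⁻¹ (subst (j <_) (trans (length-++ vis) (+-comm _ 1)) j<∣vis′∣)) (≮⇒≥ j≮∣vis∣)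
    v∉ : v ∉ vis
    v∉ v∈ = <-asym (subst (j <_) (indexOf-++ˡ vis [ w ] v∈) j<v)
                   (subst (indexOf v vis <_) (sym j≡) (indexOf<length vis v∈))
    pv∈ : parent τ v ∈ vis
    pv∈ = indexOf-++<length⇒∈ vis [ w ] (subst (_ <_) j≡ pv<j)
    w≢v : w ≢ v
    w≢v refl = <-irrefl (trans j≡ (sym (indexOf-snoc-new vis w∉))) j<v
    w<v : w < v
    w<v = ≤∧≢⇒< (≮⇒≥ (λ v<w → least v<w (v∉ , pv∈))) w≢v

  SearchPrefix-snoc : ∀ {vis w} → SearchPrefix vis → LeastAvailable vis w → SearchPrefix (vis ++ [ w ])
  SearchPrefix-snoc {vis} {w} sp lw@(w≤n , (w∉ , pw∈) , _) = record
    { root-first   = trans (nthD-++ˡ vis [ w ] (∈-length root∈)) root-first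
    ; root∈        = ∈-++⁺ˡ root∈
    ; unique       = Unique.++⁺ unique ([] ∷ []) λ { (x∈ , here refl) → w∉ x∈ }
    ; bounded      = bounded′
    ; parent-first = parent-first′
    ; greedy       = greedy-snoc sp lw
    }
    where
    open SearchPrefix sp
    bounded′ : ∀ {x} → x ∈ vis ++ [ w ] → x ≤ n
    bounded′ x∈ with ∈-++⁻ vis x∈
    ... | inj₁ x∈vis      = bounded x∈vis
    ... | inj₂ (here refl) = w≤n
    parent-first′ : ∀ {x} → x ∈ vis ++ [ w ] → x ≢ 0 →
                    indexOf (parent τ x) (vis ++ [ w ]) < indexOf x (vis ++ [ w ])
    parent-first′ x∈ x≢0 with ∈-++⁻ vis x∈
    ... | inj₁ x∈vis = subst₂ _<_ (sym (indexOf-++ˡ vis [ w ] (parentClosed x∈vis)))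
                                  (sym (indexOf-++ˡ vis [ w ] x∈vis))
                                  (parent-first x∈vis x≢0)
    ... | inj₂ (here refl) = subst₂ _<_ (sym (indexOf-++ˡ vis [ w ] pw∈)) (sym (indexOf-snoc-new vis w∉))
                                        (indexOf<length vis pw∈)

  record SearchOrder (L : List ℕ) : Set where
    field
      prefix   : SearchPrefix L
      complete : length L ≡ suc n

  module SearchOrderProperties {L : List ℕ} (so : SearchOrder L) where
    open SearchOrder so public
    open SearchPrefix prefix public

    pos : ℕ → ℕ
    pos v = indexOf v L

    ω : ℕ → ℕ
    ω j = nthD L j

    <length : ∀ {j} → j ≤ n → j < length L
    <length j≤n = subst (_ <_) (sym complete) (s≤s j≤n)

    ∈L : ∀ {v} → v ≤ n → v ∈ L
    ∈L v≤n = Unique-⊆-length≥⇒⊇ unique (Unique.upTo⁺ (suc n)) (∈-upTo⁺ ∘ s≤s ∘ bounded)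
               (≤-reflexive (trans (length-applyUpTo id (suc n)) (sym complete))) (∈-upTo⁺ (s≤s v≤n))

    pos≤ : ∀ {v} → v ≤ n → pos v ≤ n
    pos≤ v≤n = s≤s⁻¹ (subst (pos _ <_) complete (indexOf<length L (∈L v≤n)))

    ω≤ : ∀ {j} → j ≤ n → ω j ≤ n
    ω≤ j≤n = bounded (nthD∈ L (<length j≤n))

    pos-ω : ∀ {j} → j ≤ n → pos (ω j) ≡ j
    pos-ω j≤n = indexOf-nthD L unique (<length j≤n)

    ω-pos : ∀ {v} → v ≤ n → ω (pos v) ≡ v
    ω-pos v≤n = nthD-indexOf L (∈L v≤n)

    pos-injective : ∀ {u v} → u ≤ n → v ≤ n → pos u ≡ pos v → u ≡ v
    pos-injective u≤n v≤n eq = trans (sym (ω-pos u≤n)) (trans (cong ω eq) (ω-pos v≤n))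

    ω-injective : ∀ {i j} → i ≤ n → j ≤ n → ω i ≡ ω j → i ≡ j
    ω-injective i≤n j≤n eq = trans (sym (pos-ω i≤n)) (trans (cong pos eq) (pos-ω j≤n))

    pos-root : pos 0 ≡ 0
    pos-root = trans (cong pos (sym root-first)) (pos-ω z≤n)

    pos≡0⇒root : ∀ {v} → v ≤ n → pos v ≡ 0 → v ≡ 0
    pos≡0⇒root v≤n eq = pos-injective v≤n z≤n (trans eq (sym pos-root))

    ω≢root : ∀ {j} → 1 ≤ j → j ≤ n → ω j ≢ 0
    ω≢root 1≤j j≤n ωj≡0 = <⇒≢ 1≤j (sym (trans (sym (pos-ω j≤n)) (trans (cong pos ωj≡0) pos-root)))

    pos-parent< : ∀ {v} → v ≢ 0 → v ≤ n → pos (parent τ v) < pos v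
    pos-parent< v≢0 v≤n = parent-first (∈L v≤n) v≢0

    iter-parent-root : ∀ k {v} → v ≤ n → pos v ≤ k → iter k (parent τ) v ≡ 0
    iter-parent-root zero    v≤n pos≤0 = pos≡0⇒root v≤n (n≤0⇒n≡0 pos≤0)
    iter-parent-root (suc k) {v} v≤n pos≤k with v ≟ 0
    ... | yes refl = iter-parent-root k z≤n (subst (_≤ k) (sym pos-root) z≤n)
    ... | no  v≢0  = iter-parent-root k (bounded (parentClosed (∈L v≤n)))
                                        (s≤s⁻¹ (<-≤-trans (pos-parent< v≢0 v≤n) pos≤k))

    take-root∈ : ∀ {k} → 1 ≤ k → 0 ∈ take k L
    take-root∈ 1≤k = indexOf<⇒∈-take _ L root∈ (subst (_< _) (sym pos-root) 1≤k)

    take-parentClosed : ∀ k → ParentClosed (take k L)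
    take-parentClosed k {x} x∈ with x ≟ 0
    ... | yes refl = x∈
    ... | no  x≢0  = indexOf<⇒∈-take k L (parentClosed x∈L)
                                       (<-trans (parent-first x∈L x≢0) (∈-take⇒indexOf< k L x∈))
      where
      x∈L : x ∈ L
      x∈L = ∈-take k L x∈

    least-at : ∀ {k} → 1 ≤ k → k ≤ n → LeastAvailable (take k L) (ω k)
    least-at {k} 1≤k k≤n = ω≤ k≤n , (w∉ , pw∈) , least
      where
      w : ℕ
      w = ω k
      w≢0 : w ≢ 0
      w≢0 = ω≢root 1≤k k≤n
      w∉ : w ∉ take k L
      w∉ w∈ = <-irrefl (pos-ω k≤n) (∈-take⇒indexOf< k L w∈)
      pw∈ : parent τ w ∈ take k L
      pw∈ = indexOf<⇒∈-take k L (parentClosed (∈L (ω≤ k≤n)))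
                                (subst (pos (parent τ w) <_) (pos-ω k≤n) (pos-parent< w≢0 (ω≤ k≤n)))
      least : ∀ {u} → u < w → ¬ Available (take k L) u
      least {u} u<w (u∉ , pu∈) = <-asym u<w (greedy u≢0 u≤n (<length k≤n) pu<k k<pu)
        where
        u≤n : u ≤ n
        u≤n = ≤-trans (<⇒≤ u<w) (ω≤ k≤n)
        u≢0 : u ≢ 0
        u≢0 refl = u∉ (take-root∈ 1≤k)
        pu<k : pos (parent τ u) < k
        pu<k = ∈-take⇒indexOf< k L pu∈
        k<pu : k < pos u
        k<pu = ≤∧≢⇒< (≮⇒≥ (u∉ ∘ indexOf<⇒∈-take k L (∈L u≤n)))
                     (λ k≡pu → <-irrefl (sym (trans (cong ω k≡pu) (ω-pos u≤n))) u<w)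

  search-step : ∀ {vis w} fuel → nextVertex τ vis ≡ just w → search τ (suc fuel) vis ≡ search τ fuel (vis ++ [ w ])
  search-step fuel next≡w rewrite next≡w = refl

  search-take : ∀ {L} → SearchOrder L → ∀ fuel {k} → 1 ≤ k → k + fuel ≡ suc n → search τ fuel (take k L) ≡ L
  search-take {L} so zero {k} _ k+0≡ = take-all k L (≤-reflexive (trans complete (trans (sym k+0≡) (+-identityʳ k))))
    where open SearchOrder so
  search-take {L} so (suc fuel) {k} 1≤k k+fuel≡ = begin
    search τ (suc fuel) (take k L)
      ≡⟨ search-step fuel (least⇒nextVertex (take-root∈ 1≤k) (take-parentClosed k) (least-at 1≤k k≤n)) ⟩
    search τ fuel (take k L ++ [ ω k ])   ≡⟨ cong (search τ fuel) (take-suc-nthD k L (<length k≤n)) ⟨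
    search τ fuel (take (suc k) L)        ≡⟨ search-take so fuel (s≤s z≤n) (trans (sym (+-suc k fuel)) k+fuel≡) ⟩
    L                                     ∎
    where
    open ≡-Reasoning
    open SearchOrderProperties so
    k≤n : k ≤ n
    k≤n = m+1+k≡1+n⇒m≤n k+fuel≡

  wearyList-unique : ∀ {L} → SearchOrder L → wearyList τ ≡ L
  wearyList-unique {L} so = trans (cong (search τ n) (sym take-1)) (search-take so n (s≤s z≤n) refl)
    where
    open SearchOrderProperties so
    take-1 : take 1 L ≡ [ 0 ]
    take-1 = trans (take-suc-nthD 0 L (<length z≤n)) (cong [_] root-first)

  module _ (tree : IsTree τ) where
    open IsTree tree

    unvisited-exists : ∀ {vis} → Unique vis → length vis ≤ n → ∃[ v ] (v ≤ n × v ∉ vis)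
    unvisited-exists {vis} uvis ∣vis∣≤n with All.all? (_∈? vis) (upTo (suc n))
    ... | yes all∈ = contradiction (Unique-⊆⇒length≤ (Unique.upTo⁺ (suc n)) uvis (All.lookup all∈))
                                   (<⇒≱ (subst (length vis <_) (sym (length-applyUpTo id (suc n))) (s≤s ∣vis∣≤n)))
    ... | no ¬all∈ with find (AllP.¬All⇒Any¬ (_∈? vis) _ ¬all∈)
    ...   | v , v∈ , v∉ = v , s≤s⁻¹ (∈-upTo⁻ v∈) , v∉

    -- Walk up from an unvisited vertex towards the visited root; the last unvisited
    -- vertex on the way is available.
    available-exists : ∀ {vis} → SearchPrefix vis → length vis ≤ n → ∃[ u ] (u ≤ n × Available vis u)
    available-exists {vis} sp ∣vis∣≤n with unvisited-exists (SearchPrefix.unique sp) ∣vis∣≤n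
    ... | v , v≤n , v∉ =
      escape n v≤n v∉ (subst (_∈ vis) (sym (reachesRoot (n≢0⇒n>0 λ { refl → v∉ root∈ }) v≤n)) root∈)
      where
      open SearchPrefix sp
      escape : ∀ k {x} → x ≤ n → x ∉ vis → iter k (parent τ) x ∈ vis → ∃[ u ] (u ≤ n × Available vis u)
      escape zero          x≤n x∉ x∈ = contradiction x∈ x∉
      escape (suc k) {x} x≤n x∉ up∈ with parent τ x ∈? vis
      ... | yes px∈ = x , x≤n , x∉ , px∈
      ... | no  px∉ = escape k (parent≤ tree x) px∉ up∈

    search-extends : ∀ {vis} → SearchPrefix vis → length vis ≤ n →
                     ∃[ w ] (nextVertex τ vis ≡ just w × SearchPrefix (vis ++ [ w ]))
    search-extends sp ∣vis∣≤n with available-exists sp ∣vis∣≤n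
    ... | u , u≤n , avail with available⇒nextVertex (SearchPrefix.root∈ sp) (SearchPrefix.parentClosed sp) u≤n avail
    ...   | w , next≡w = w , next≡w , SearchPrefix-snoc sp (nextVertex⇒least root∈ parentClosed next≡w)
      where open SearchPrefix sp

    search-order : ∀ fuel {vis} → SearchPrefix vis → length vis + fuel ≡ suc n → SearchOrder (search τ fuel vis)
    search-order zero       sp len = record { prefix = sp ; complete = trans (sym (+-identityʳ _)) len }
    search-order (suc fuel) {vis} sp len with search-extends sp (m+1+k≡1+n⇒m≤n len)
    ... | w , next≡w , sp′ = subst SearchOrder (sym (search-step fuel next≡w))
      (search-order fuel sp′ (trans (cong (_+ fuel) (length-++ vis)) (trans (+-assoc (length vis) 1 fuel) len)))

    wearyList-order : SearchOrder (wearyList τ)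
    wearyList-order = search-order n root-prefix refl

-- Parking

FirstFreeFrom : List ℕ → ℕ → ℕ → Set
FirstFreeFrom occ a s = a ≤ s × s ∉ occ × (∀ {x} → a ≤ x → x < s → x ∈ occ)

findFree⇒FirstFreeFrom : ∀ {occ} fuel a {s} → findFree occ fuel a ≡ just s → FirstFreeFrom occ a s × s < a + fuel
findFree⇒FirstFreeFrom {occ} (suc fuel) a {s} eq with memB a occ | memB-reflects a occ
... | false | ofⁿ a∉ with refl ← eq =
  (≤-refl , a∉ , λ a≤x x<a → contradiction a≤x (<⇒≱ x<a)) , m<m+n a (s≤s z≤n)
... | true  | ofʸ a∈ with findFree⇒FirstFreeFrom fuel (suc a) eq
...   | (a<s , s∉ , occupied) , s<a+1+fuel = (<⇒≤ a<s , s∉ , occupied′) , subst (s <_) (sym (+-suc a fuel)) s<a+1+fuel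
  where
  occupied′ : ∀ {x} → a ≤ x → x < s → x ∈ occ
  occupied′ a≤x x<s with m≤n⇒m<n∨m≡n a≤x
  ... | inj₁ a<x  = occupied a<x x<s
  ... | inj₂ refl = a∈

FirstFreeFrom⇒findFree : ∀ {occ} fuel a {s} → FirstFreeFrom occ a s → s < a + fuel → findFree occ fuel a ≡ just s
FirstFreeFrom⇒findFree zero a (a≤s , _) s<a+0 = contradiction (subst (_ <_) (+-identityʳ a) s<a+0) (≤⇒≯ a≤s)
FirstFreeFrom⇒findFree {occ} (suc fuel) a {s} (a≤s , s∉ , occupied) s<a+1+fuel
  with memB a occ | memB-reflects a occ | m≤n⇒m<n∨m≡n a≤s
... | true  | ofʸ a∈ | inj₂ refl = contradiction a∈ s∉
... | true  | ofʸ a∈ | inj₁ a<s  =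
  FirstFreeFrom⇒findFree fuel (suc a) (a<s , s∉ , occupied ∘ <⇒≤) (subst (s <_) (+-suc a fuel) s<a+1+fuel)
... | false | ofⁿ a∉ | inj₂ refl = refl
... | false | ofⁿ a∉ | inj₁ a<s  = contradiction (occupied ≤-refl a<s) a∉

-- findFree is given the fuel 1 + n ∸ a, so exactly the spots a, …, n are tried.
fuel-bound⇒≤ : ∀ {n a s} → a ≤ s → s < a + (suc n ∸ a) → s ≤ n
fuel-bound⇒≤ {n} {a} {s} a≤s s< with a ≤? suc n
... | yes a≤1+n = s≤s⁻¹ (subst (s <_) (m+[n∸m]≡n a≤1+n) s<)
... | no  a≰1+n = contradiction (subst (s <_) a+fuel≡a s<) (≤⇒≯ a≤s)
  where
  a+fuel≡a : a + (suc n ∸ a) ≡ a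
  a+fuel≡a = trans (cong (a +_) (m≤n⇒m∸n≡0 (<⇒≤ (≰⇒> a≰1+n)))) (+-identityʳ a)

≤⇒fuel-bound : ∀ {n a s} → a ≤ s → s ≤ n → s < a + (suc n ∸ a)
≤⇒fuel-bound {n} {a} {s} a≤s s≤n = subst (s <_) (sym (m+[n∸m]≡n (≤-trans a≤s (m≤n⇒m≤1+n s≤n)))) (s≤s s≤n)

data Parks (n : ℕ) : List ℕ → List ℕ → List ℕ → Set where
  []   : ∀ {occ} → Parks n occ [] []
  park : ∀ {occ a s as ss} → FirstFreeFrom occ a s → s ≤ n →
         Parks n (occ ++ [ s ]) as ss → Parks n occ (a ∷ as) (s ∷ ss)

parkFrom⇒Parks : ∀ n occ as {R} → parkFrom n occ as ≡ just R → ∃[ ss ] (R ≡ occ ++ ss × Parks n occ as ss)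
parkFrom⇒Parks n occ []       refl = [] , sym (++-identityʳ occ) , []
parkFrom⇒Parks n occ (a ∷ as) eq with findFree occ (suc n ∸ a) a in found
... | just s with parkFrom⇒Parks n (occ ++ [ s ]) as eq | findFree⇒FirstFreeFrom (suc n ∸ a) a found
...   | ss , refl , parks | free@(a≤s , _) , s<fuel =
  s ∷ ss , ++-assoc occ [ s ] ss , park free (fuel-bound⇒≤ a≤s s<fuel) parks

Parks⇒parkFrom : ∀ {n occ as ss} → Parks n occ as ss → parkFrom n occ as ≡ just (occ ++ ss)
Parks⇒parkFrom {occ = occ} [] = cong just (sym (++-identityʳ occ))
Parks⇒parkFrom {n} {occ} {a ∷ as} {s ∷ ss} (park free@(a≤s , _) s≤n parks)
  rewrite FirstFreeFrom⇒findFree (suc n ∸ a) a free (≤⇒fuel-bound a≤s s≤n)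
  = trans (Parks⇒parkFrom parks) (cong just (++-assoc occ [ s ] ss))

CarParks : ℕ → List ℕ → List ℕ → List ℕ → ℕ → Set
CarParks n occ as ss i = FirstFreeFrom (occ ++ take i ss) (nthD as i) (nthD ss i) × nthD ss i ≤ n

FirstFreeFrom-resp : ∀ {occ occ′ a s} → occ ≡ occ′ → FirstFreeFrom occ a s → FirstFreeFrom occ′ a s
FirstFreeFrom-resp {a = a} {s} = subst (λ o → FirstFreeFrom o a s)

Parks-length : ∀ {n occ as ss} → Parks n occ as ss → length ss ≡ length as
Parks-length []                = refl
Parks-length (park _ _ parks) = cong suc (Parks-length parks)

Parks⇒CarParks : ∀ {n occ as ss} → Parks n occ as ss → ∀ {i} → i < length as → CarParks n occ as ss i
Parks⇒CarParks {occ = occ} (park free s≤n parks) {zero} _ = FirstFreeFrom-resp (sym (++-identityʳ occ)) free , s≤n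
Parks⇒CarParks {occ = occ} {ss = s ∷ ss} (park free s≤n parks) {suc i} (s≤s i<) with Parks⇒CarParks parks i<
... | free′ , sᵢ≤n = FirstFreeFrom-resp (++-assoc occ [ s ] (take i ss)) free′ , sᵢ≤n

CarParks⇒Parks : ∀ {n occ} as ss → length ss ≡ length as →
                 (∀ {i} → i < length as → CarParks n occ as ss i) → Parks n occ as ss
CarParks⇒Parks []       []       _   _    = []
CarParks⇒Parks {occ = occ} (a ∷ as) (s ∷ ss) len cars with cars {0} (s≤s z≤n)
... | free , s≤n =
  park (FirstFreeFrom-resp (++-identityʳ occ) free) s≤n (CarParks⇒Parks as ss (suc-injective len) cars′)
  where
  cars′ : ∀ {i} → i < length as → CarParks _ (occ ++ [ s ]) as ss i
  cars′ i< with cars (s≤s i<)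
  ... | free′ , sᵢ≤n = FirstFreeFrom-resp (sym (++-assoc occ [ s ] _)) free′ , sᵢ≤n

Parks-unique : ∀ {n occ as ss} → Unique occ → Parks n occ as ss → Unique (occ ++ ss)
Parks-unique {occ = occ} uocc [] = subst Unique (sym (++-identityʳ occ)) uocc
Parks-unique {occ = occ} {ss = s ∷ ss} uocc (park (_ , s∉ , _) _ parks) =
  subst Unique (++-assoc occ [ s ] ss)
    (Parks-unique (Unique.++⁺ uocc ([] ∷ []) λ { (s∈ , here refl) → s∉ s∈ }) parks)

Parks-bounded : ∀ {n occ as ss} → Parks n occ as ss → (∀ {a} → a ∈ as → 1 ≤ a) →
                ∀ {s} → s ∈ ss → 1 ≤ s × s ≤ n
Parks-bounded (park (a≤s , _) s≤n _)  as≥1 (here refl) = ≤-trans (as≥1 (here refl)) a≤s , s≤n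
Parks-bounded (park _ _ parks) as≥1 (there s∈)  = Parks-bounded parks (as≥1 ∘ there) s∈

isKAry⇔ : ∀ k {n} (τ : Vec ℕ n) → T (isKAry k τ) ⇔ (∀ {v} → v ≤ n → children τ v ≤ k)
isKAry⇔ k {n} τ = mk⇔ to from
  where
  to : T (isKAry k τ) → ∀ {v} → v ≤ n → children τ v ≤ k
  to h v≤n = ≤ᵇ⇒≤ _ k (Equivalence.to (T-all⇔ _ (range 0 n)) h (∈-range⁺ z≤n v≤n))
  from : (∀ {v} → v ≤ n → children τ v ≤ k) → T (isKAry k τ)
  from h = Equivalence.from (T-all⇔ _ (range 0 n)) λ v∈ → ≤⇒≤ᵇ (h (proj₂ (∈-range⁻ 0 n v∈)))

atMost⇔ : ∀ k {n} (π : Vec ℕ n) → T (atMost k π) ⇔ (∀ {j} → j ≤ n → occ π (suc j) ≤ k)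
atMost⇔ k {n} π = mk⇔ to from
  where
  to : T (atMost k π) → ∀ {j} → j ≤ n → occ π (suc j) ≤ k
  to h j≤n = ≤ᵇ⇒≤ _ k (Equivalence.to (T-all⇔ _ (range 1 (suc n))) h (∈-range⁺ (s≤s z≤n) (s≤s j≤n)))
  from : (∀ {j} → j ≤ n → occ π (suc j) ≤ k) → T (atMost k π)
  from h = Equivalence.from (T-all⇔ _ (range 1 (suc n))) λ j∈ → ≤⇒≤ᵇ (bounded j∈)
    where
    bounded : ∀ {j} → j ∈ range 1 (suc n) → occ π j ≤ k
    bounded {suc j} j∈ = h (s≤s⁻¹ (proj₂ (∈-range⁻ 1 (suc n) j∈)))
    bounded {zero}  j∈ = contradiction (proj₁ (∈-range⁻ 1 (suc n) j∈)) λ ()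

IsPreference : ∀ {n} → Vec ℕ n → Set
IsPreference {n} π = ∀ {a} → a ∈ toList π → 1 ≤ a × a ≤ n

isParkingFunction⇔ : ∀ {n} (π : Vec ℕ n) →
                     T (isParkingFunction π) ⇔ (IsPreference π × ∃[ S ] spots π ≡ just S)
isParkingFunction⇔ {n} π = mk⇔ to from
  where
  bounds⇔ : ∀ a → T ((1 ≤ᵇ a) ∧ (a ≤ᵇ n)) ⇔ (1 ≤ a × a ≤ n)
  bounds⇔ a = mk⇔ (λ h → let 1≤a , a≤n = Equivalence.to T-∧ h in ≤ᵇ⇒≤ 1 a 1≤a , ≤ᵇ⇒≤ a n a≤n)
                  (λ { (1≤a , a≤n) → Equivalence.from T-∧ (≤⇒≤ᵇ 1≤a , ≤⇒≤ᵇ a≤n) })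
  is-just⇒∃just : ∀ (m : Maybe (List ℕ)) → T (is-just m) → ∃[ S ] m ≡ just S
  is-just⇒∃just (just S) _ = S , refl
  to : T (isParkingFunction π) → IsPreference π × ∃[ S ] spots π ≡ just S
  to h with Equivalence.to T-∧ h
  ... | prefs , parks =
    (λ {a} a∈ → Equivalence.to (bounds⇔ a) (Equivalence.to (T-all⇔ _ (toList π)) prefs a∈)) ,
    is-just⇒∃just (spots π) parks
  from : IsPreference π × ∃[ S ] spots π ≡ just S → T (isParkingFunction π)
  from (prefs , S , spots≡S) = Equivalence.from T-∧
    ( Equivalence.from (T-all⇔ _ (toList π)) (λ {a} a∈ → Equivalence.from (bounds⇔ a) (prefs a∈))
    , subst (T ∘ is-just) (sym spots≡S) _ )

-- Trees and parking functions

-- Spot j of the street plays the role of the j-th visited vertex, and car i the role of vertex i.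
carAtSpot : List ℕ → ℕ → ℕ
carAtSpot S zero    = 0
carAtSpot S (suc j) = suc (indexOf (suc j) S)

carAtSpot-suc : ∀ S {s} → s ≢ 0 → carAtSpot S s ≡ suc (indexOf s S)
carAtSpot-suc S {zero}  s≢0 = contradiction refl s≢0
carAtSpot-suc S {suc s} _   = refl

treeOf : ∀ {n} → Vec ℕ n → Vec ℕ n
treeOf π = Vec.map (λ a → carAtSpot (fromMaybe [] (spots π)) (pred a)) π

treeOf-spots : ∀ {n} {π : Vec ℕ n} {S} → spots π ≡ just S → treeOf π ≡ Vec.map (carAtSpot S ∘ pred) π
treeOf-spots {π = π} spots≡S = cong (λ m → Vec.map (λ a → carAtSpot (fromMaybe [] m) (pred a)) π) spots≡S

module TreeToParking {n : ℕ} {τ : Vec ℕ n} (tree : IsTree τ) where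
  open PrioritySearch τ
  open SearchOrderProperties (wearyList-order tree)

  π : Vec ℕ n
  π = prefSeq τ

  preference : ℕ → ℕ
  preference i = suc (pos (parent τ (suc i)))

  spot : ℕ → ℕ
  spot i = pos (suc i)

  S : List ℕ
  S = applyUpTo spot n

  toList-π : toList π ≡ map (suc ∘ pos) (toList τ)
  toList-π = Vec.toList-map (suc ∘ pos) τ

  preferences : toList π ≡ applyUpTo preference n
  preferences = trans toList-π (trans (cong (map (suc ∘ pos)) (toList-parent τ)) (map-applyUpTo _ (suc ∘ pos) n))

  spot-injective : ∀ {i j} → i < n → j < n → spot i ≡ spot j → i ≡ j
  spot-injective i<n j<n eq = suc-injective (pos-injective i<n j<n eq)

  -- Spot x strictly between pos (parent v) and pos v holds the vertex ω x, which is
  -- smaller than v by greediness; so car ω x came earlier and took spot x.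
  parks-at : ∀ {i} → i < n → FirstFreeFrom (applyUpTo spot i) (preference i) (spot i) × spot i ≤ n
  parks-at {i} i<n = (pos-parent< (λ ()) i<n , taken-spot∉ , occupied) , pos≤ i<n
    where
    taken-spot∉ : spot i ∉ applyUpTo spot i
    taken-spot∉ sᵢ∈ with ∈-applyUpTo⁻ spot sᵢ∈
    ... | k , k<i , eq = <-irrefl (sym (spot-injective i<n (<-trans k<i i<n) eq)) k<i
    occupied : ∀ {x} → preference i ≤ x → x < spot i → x ∈ applyUpTo spot i
    occupied {x} pref≤x x<spot =
      subst (_∈ applyUpTo spot i) (trans (cong pos (sym ωx≡)) (pos-ω x≤n)) (∈-applyUpTo⁺ spot k<i)
      where
      x≤n : x ≤ n
      x≤n = ≤-trans (<⇒≤ x<spot) (pos≤ i<n)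
      ωx<v : ω x < suc i
      ωx<v = greedy (λ ()) i<n (<length x≤n) pref≤x x<spot
      k : ℕ
      k = pred (ω x)
      ωx≡ : ω x ≡ suc k
      ωx≡ = sym (suc-pred (ω x) {{≢-nonZero (ω≢root (≤-trans (s≤s z≤n) pref≤x) x≤n)}})
      k<i : k < i
      k<i = s≤s⁻¹ (subst (_< suc i) ωx≡ ωx<v)

  spots-π : spots π ≡ just S
  spots-π = trans (cong (parkFrom n []) preferences)
                  (Parks⇒parkFrom (CarParks⇒Parks (applyUpTo preference n) S lengths cars))
    where
    lengths : length S ≡ length (applyUpTo preference n)
    lengths = trans (length-applyUpTo spot n) (sym (length-applyUpTo preference n))
    cars : ∀ {i} → i < length (applyUpTo preference n) → CarParks n [] (applyUpTo preference n) S i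
    cars {i} i<
      rewrite length-applyUpTo preference n
            | nthD-applyUpTo preference n i< | nthD-applyUpTo spot n i< | take-applyUpTo spot n (<⇒≤ i<)
      = parks-at i<

  π-isParkingFunction : T (isParkingFunction π)
  π-isParkingFunction = Equivalence.from (isParkingFunction⇔ π) (preference-bounds , S , spots-π)
    where
    preference-bounds : IsPreference π
    preference-bounds a∈ with ∈-applyUpTo⁻ preference (subst (_ ∈_) preferences a∈)
    ... | i , i<n , refl = s≤s z≤n , ≤-trans (pos-parent< (λ ()) i<n) (pos≤ i<n)

  ≡ᵇ-pos : ∀ {u v} → u ≤ n → v ≤ n → (pos u ≡ᵇ pos v) ≡ (u ≡ᵇ v)
  ≡ᵇ-pos u≤n v≤n = ≡ᵇ-cong (mk⇔ (pos-injective u≤n v≤n) (cong pos))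

  children≡occ : ∀ {v} → v ≤ n → children τ v ≡ occ π (suc (pos v))
  children≡occ {v} v≤n = sym (begin
    occ π (suc (pos v))                                   ≡⟨ cong (countB _) toList-π ⟩
    countB (suc (pos v) ≡ᵇ_) (map (suc ∘ pos) (toList τ)) ≡⟨ countB-map _ (suc ∘ pos) (toList τ) ⟩
    countB (λ x → pos v ≡ᵇ pos x) (toList τ)              ≡⟨ countB-cong (toList τ) (λ x∈ → ≡ᵇ-pos v≤n (label≤ x∈)) ⟩
    children τ v                                          ∎)
    where
    open ≡-Reasoning
    open IsTree tree

  degRoot≡ones : degRoot τ ≡ ones π
  degRoot≡ones = sym (begin
    ones π                                      ≡⟨ cong (countB _) toList-π ⟩
    countB (_≡ᵇ 1) (map (suc ∘ pos) (toList τ)) ≡⟨ countB-map _ (suc ∘ pos) (toList τ) ⟩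
    countB (λ x → pos x ≡ᵇ 0) (toList τ)        ≡⟨ countB-cong (toList τ) (λ x∈ → ≡ᵇ-cong (pos≡0⇔ (label≤ x∈))) ⟩
    degRoot τ                                   ∎)
    where
    open ≡-Reasoning
    open IsTree tree
    pos≡0⇔ : ∀ {x} → x ≤ n → (pos x ≡ 0) ⇔ (0 ≡ x)
    pos≡0⇔ x≤n = mk⇔ (sym ∘ pos≡0⇒root x≤n) (λ { refl → pos-root })

  ω-↭ : map ω (range 1 n) ↭ range 1 n
  ω-↭ = map-↭-self (range-unique 1 n) injective into
    where
    injective : ∀ {x y} → x ∈ range 1 n → y ∈ range 1 n → ω x ≡ ω y → x ≡ y
    injective x∈ y∈ = ω-injective (proj₂ (∈-range⁻ 1 n x∈)) (proj₂ (∈-range⁻ 1 n y∈))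
    into : ∀ {x} → x ∈ range 1 n → ω x ∈ range 1 n
    into x∈ with ∈-range⁻ 1 n x∈
    ... | 1≤x , x≤n = ∈-range⁺ (n≢0⇒n>0 (ω≢root 1≤x x≤n)) (ω≤ x≤n)

  pos-↭ : map pos (upTo (suc n)) ↭ upTo (suc n)
  pos-↭ = map-↭-self (Unique.upTo⁺ (suc n))
    (λ x∈ y∈ → pos-injective (s≤s⁻¹ (∈-upTo⁻ x∈)) (s≤s⁻¹ (∈-upTo⁻ y∈)))
    (λ x∈ → ∈-upTo⁺ (s≤s (pos≤ (s≤s⁻¹ (∈-upTo⁻ x∈)))))

  preference-and-spot : ℕ → ℕ × ℕ
  preference-and-spot v = suc (pos (parent τ v)) , pos v

  isLucky : ℕ → Bool
  isLucky v = suc (pos (parent τ v)) ≡ᵇ pos v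

  displacement : ℕ → ℕ
  displacement v = pos v ∸ suc (pos (parent τ v))

  prefSpots-π : prefSpots π ≡ map preference-and-spot (range 1 n)
  prefSpots-π = begin
    zip (toList π) (fromMaybe [] (spots π))   ≡⟨ cong₂ zip preferences (cong (fromMaybe []) spots-π) ⟩
    zip (applyUpTo preference n) S            ≡⟨ zip-applyUpTo preference spot n ⟩
    applyUpTo (preference-and-spot ∘ suc) n   ≡⟨ map-applyUpTo suc preference-and-spot n ⟨
    map preference-and-spot (applyUpTo suc n) ≡⟨ cong (map preference-and-spot) (map-applyUpTo id suc n) ⟨
    map preference-and-spot (range 1 n)       ∎
    where open ≡-Reasoning

  -- The statistics of pt(τ) at i are those of car ω i; ω permutes 1, …, n.
  psa≡lucky : psa τ ≡ lucky π
  psa≡lucky = begin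
    psa τ                                          ≡⟨ countB-cong (range 1 n) (λ i∈ → isLucky-ω (∈-range⁻ 1 n i∈)) ⟩
    countB (isLucky ∘ ω) (range 1 n)               ≡⟨ countB-map isLucky ω (range 1 n) ⟨
    countB isLucky (map ω (range 1 n))             ≡⟨ countB-↭ isLucky ω-↭ ⟩
    countB isLucky (range 1 n)                     ≡⟨ countB-map _ preference-and-spot (range 1 n) ⟨
    countB _ (map preference-and-spot (range 1 n)) ≡⟨ cong (countB _) prefSpots-π ⟨
    lucky π                                        ∎
    where
    open ≡-Reasoning
    isLucky-ω : ∀ {i} → 1 ≤ i × i ≤ n → (ptParent τ i ≡ᵇ i ∸ 1) ≡ isLucky (ω i)
    isLucky-ω {suc i} (_ , i≤n) rewrite pos-ω i≤n = refl

  wait≡probes : wait τ ≡ probes π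
  wait≡probes = begin
    wait τ
      ≡⟨ cong sum (map-cong-local (All.tabulate λ i∈ → gap-ω (proj₂ (∈-range⁻ 1 n i∈)))) ⟩
    sum (map (gap ∘ ω) (range 1 n))
      ≡⟨ cong sum (map-∘ (range 1 n)) ⟩
    sum (map gap (map ω (range 1 n)))
      ≡⟨ sum-↭ (map⁺ gap ω-↭) ⟩
    sum (map gap (range 1 n))
      ≡⟨ cong sum (map-cong-local (All.tabulate λ v∈ → gap≡suc (∈-range⁻ 1 n v∈))) ⟩
    sum (map (suc ∘ displacement) (range 1 n))
      ≡⟨ sum-map-suc displacement (range 1 n) ⟩
    length (range 1 n) + sum (map displacement (range 1 n))
      ≡⟨ cong (_+ sum (map displacement (range 1 n))) (length-range 1 n) ⟩
    n + sum (map displacement (range 1 n))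
      ≡⟨ cong (λ xs → n + sum xs) (map-∘ (range 1 n)) ⟩
    n + sum (map _ (map preference-and-spot (range 1 n)))
      ≡⟨ cong (λ xs → n + sum (map _ xs)) prefSpots-π ⟨
    probes π
      ∎
    where
    open ≡-Reasoning
    gap : ℕ → ℕ
    gap v = pos v ∸ pos (parent τ v)
    gap-ω : ∀ {i} → i ≤ n → i ∸ ptParent τ i ≡ gap (ω i)
    gap-ω {i} i≤n = cong (_∸ ptParent τ i) (sym (pos-ω i≤n))
    gap≡suc : ∀ {v} → 1 ≤ v × v ≤ n → gap v ≡ suc (displacement v)
    gap≡suc (1≤v , v≤n) = +-∸-assoc 1 (pos-parent< (>⇒≢ 1≤v) v≤n)

  chseq≡mult : chseq τ ≡ mult π
  chseq≡mult = map-cong count≡ (range 0 n)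
    where
    open ≡-Reasoning
    U : List ℕ
    U = upTo (suc n)
    count≡ : ∀ i → countB (λ v → children τ v ≡ᵇ i) (range 0 n) ≡ countB (λ j → occ π j ≡ᵇ i) (range 1 (suc n))
    count≡ i = begin
      countB (λ v → children τ v ≡ᵇ i) (range 0 n)
        ≡⟨ cong (countB _) (range0≡upTo n) ⟩
      countB (λ v → children τ v ≡ᵇ i) U
        ≡⟨ countB-cong U (λ v∈ → cong (_≡ᵇ i) (children≡occ (s≤s⁻¹ (∈-upTo⁻ v∈)))) ⟩
      countB (λ v → occ π (suc (pos v)) ≡ᵇ i) U
        ≡⟨ countB-map (λ j → occ π (suc j) ≡ᵇ i) pos U ⟨
      countB (λ j → occ π (suc j) ≡ᵇ i) (map pos U)
        ≡⟨ countB-↭ _ pos-↭ ⟩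
      countB (λ j → occ π (suc j) ≡ᵇ i) U
        ≡⟨ countB-map (λ j → occ π j ≡ᵇ i) suc U ⟨
      countB (λ j → occ π j ≡ᵇ i) (range 1 (suc n))
        ∎

  isKAry⇔atMost : ∀ k → T (isKAry k τ) ⇔ T (atMost k π)
  isKAry⇔atMost k = mk⇔
    (λ h → Equivalence.from (atMost⇔ k π) λ j≤n →
      subst (_≤ k) (children-ω j≤n) (Equivalence.to (isKAry⇔ k τ) h (ω≤ j≤n)))
    (λ h → Equivalence.from (isKAry⇔ k τ) λ v≤n →
      subst (_≤ k) (sym (children≡occ v≤n)) (Equivalence.to (atMost⇔ k π) h (pos≤ v≤n)))
    where
    children-ω : ∀ {j} → j ≤ n → children τ (ω j) ≡ occ π (suc j)
    children-ω j≤n = trans (children≡occ (ω≤ j≤n)) (cong (occ π ∘ suc) (pos-ω j≤n))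

  treeOf-π : treeOf π ≡ τ
  treeOf-π = begin
    treeOf π                                   ≡⟨ treeOf-spots spots-π ⟩
    Vec.map (carAtSpot S ∘ pred) (Vec.map (suc ∘ pos) τ) ≡⟨ Vec.map-∘ (carAtSpot S ∘ pred) (suc ∘ pos) τ ⟨
    Vec.map (carAtSpot S ∘ pos) τ              ≡⟨ Vec-map-id-local τ (carAtSpot-pos ∘ IsTree.label≤ tree) ⟩
    τ                                          ∎
    where
    open ≡-Reasoning
    S-unique : Unique S
    S-unique = Unique.applyUpTo⁺₁ spot n (λ i<j j<n eq → <⇒≢ i<j (spot-injective (<-trans i<j j<n) j<n eq))
    pos≢0 : ∀ {i} → i < n → pos (suc i) ≢ 0
    pos≢0 i<n pos≡0 = contradiction (pos≡0⇒root i<n pos≡0) λ ()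
    carAtSpot-pos : ∀ {x} → x ≤ n → carAtSpot S (pos x) ≡ x
    carAtSpot-pos {zero}  _   = cong (carAtSpot S) pos-root
    carAtSpot-pos {suc i} i<n = trans (carAtSpot-suc S (pos≢0 i<n)) (cong suc (begin
      indexOf (spot i) S       ≡⟨ cong (λ x → indexOf x S) (nthD-applyUpTo spot n i<n) ⟨
      indexOf (nthD S i) S     ≡⟨ indexOf-nthD S S-unique (subst (i <_) (sym (length-applyUpTo spot n)) i<n) ⟩
      i                        ∎))

module ParkingToTree {n : ℕ} {π : Vec ℕ n} (pf : T (isParkingFunction π)) where

  as : List ℕ
  as = toList π

  preference-bounds : IsPreference π
  preference-bounds = proj₁ (Equivalence.to (isParkingFunction⇔ π) pf)

  S : List ℕ
  S = proj₁ (proj₂ (Equivalence.to (isParkingFunction⇔ π) pf))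

  spots≡S : spots π ≡ just S
  spots≡S = proj₂ (proj₂ (Equivalence.to (isParkingFunction⇔ π) pf))

  parks : Parks n [] as S
  parks with parkFrom⇒Parks n [] as spots≡S
  ... | _ , refl , parks = parks

  S-unique : Unique S
  S-unique = Parks-unique [] parks

  S-length : length S ≡ n
  S-length = trans (Parks-length parks) (Vec.length-toList π)

  S-bounded : ∀ {s} → s ∈ S → 1 ≤ s × s ≤ n
  S-bounded = Parks-bounded parks (proj₁ ∘ preference-bounds)

  S-full : ∀ {s} → 1 ≤ s → s ≤ n → s ∈ S
  S-full 1≤s s≤n = Unique-⊆-length≥⇒⊇ S-unique (range-unique 1 n)
    (λ s∈ → let 1≤s , s≤n = S-bounded s∈ in ∈-range⁺ 1≤s s≤n)
    (≤-reflexive (trans (length-range 1 n) (sym S-length)))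
    (∈-range⁺ 1≤s s≤n)

  i<∣as∣ : ∀ {i} → i < n → i < length as
  i<∣as∣ {i} = subst (i <_) (sym (Vec.length-toList π))

  a≥1 : ∀ {i} → i < n → 1 ≤ nthD as i
  a≥1 i<n = proj₁ (preference-bounds (nthD∈ as (i<∣as∣ i<n)))

  car-parks : ∀ {i} → i < n → CarParks n [] as S i
  car-parks i<n = Parks⇒CarParks parks (i<∣as∣ i<n)

  ω′ : ℕ → ℕ
  ω′ = carAtSpot S

  τ′ : Vec ℕ n
  τ′ = treeOf π

  ω′≤ : ∀ {j} → j ≤ n → ω′ j ≤ n
  ω′≤ {zero}  _   = z≤n
  ω′≤ {suc j} j<n = subst (indexOf (suc j) S <_) S-length (indexOf<length S (S-full (s≤s z≤n) j<n))

  ω′-injective : ∀ {i j} → i ≤ n → j ≤ n → ω′ i ≡ ω′ j → i ≡ j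
  ω′-injective {zero}  {zero}  _   _   _  = refl
  ω′-injective {suc i} {suc j} i<n j<n eq = trans (sym (nthD-indexOf S (S-full (s≤s z≤n) i<n)))
    (trans (cong (nthD S) (suc-injective eq)) (nthD-indexOf S (S-full (s≤s z≤n) j<n)))

  ω′-spot : ∀ {i} → i < n → ω′ (nthD S i) ≡ suc i
  ω′-spot {i} i<n = trans (carAtSpot-suc S (>⇒≢ (proj₁ (S-bounded (nthD∈ S i<∣S∣)))))
                          (cong suc (indexOf-nthD S S-unique i<∣S∣))
    where
    i<∣S∣ : i < length S
    i<∣S∣ = subst (i <_) (sym S-length) i<n

  τ′≡ : τ′ ≡ Vec.map (ω′ ∘ pred) π
  τ′≡ = treeOf-spots spots≡S

  parent-τ′ : ∀ {i} → i < n → parent τ′ (suc i) ≡ ω′ (pred (nthD as i))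
  parent-τ′ {i} i<n = begin
    nthD (toList τ′) i                      ≡⟨ cong (λ σ → nthD (toList σ) i) τ′≡ ⟩
    nthD (toList (Vec.map (ω′ ∘ pred) π)) i ≡⟨ cong (λ xs → nthD xs i) (Vec.toList-map (ω′ ∘ pred) π) ⟩
    nthD (map (ω′ ∘ pred) as) i             ≡⟨ nthD-map (ω′ ∘ pred) as (i<∣as∣ i<n) ⟩
    ω′ (pred (nthD as i))                   ∎
    where open ≡-Reasoning

  L : List ℕ
  L = applyUpTo ω′ (suc n)

  L-length : length L ≡ suc n
  L-length = length-applyUpTo ω′ (suc n)

  L-unique : Unique L
  L-unique = Unique.applyUpTo⁺₁ ω′ (suc n) λ i<j j<1+n →
    <⇒≢ i<j ∘ ω′-injective (s≤s⁻¹ (<-trans i<j j<1+n)) (s≤s⁻¹ j<1+n)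

  nthD-L : ∀ {j} → j ≤ n → nthD L j ≡ ω′ j
  nthD-L j≤n = nthD-applyUpTo ω′ (suc n) (s≤s j≤n)

  indexOf-ω′ : ∀ {j} → j ≤ n → indexOf (ω′ j) L ≡ j
  indexOf-ω′ {j} j≤n = trans (cong (λ x → indexOf x L) (sym (nthD-L j≤n)))
                             (indexOf-nthD L L-unique (subst (j <_) (sym L-length) (s≤s j≤n)))

  indexOf-car : ∀ {i} → i < n → indexOf (suc i) L ≡ nthD S i
  indexOf-car {i} i<n = trans (cong (λ x → indexOf x L) (sym (ω′-spot i<n)))
                              (indexOf-ω′ (proj₂ (S-bounded (nthD∈ S (subst (i <_) (sym S-length) i<n)))))

  indexOf-parent : ∀ {i} → i < n → indexOf (parent τ′ (suc i)) L ≡ pred (nthD as i)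
  indexOf-parent {i} i<n = trans (cong (λ x → indexOf x L) (parent-τ′ i<n))
    (indexOf-ω′ (≤-trans pred[n]≤n (proj₂ (preference-bounds (nthD∈ as (i<∣as∣ i<n))))))

  open PrioritySearch τ′

  L-bounded : ∀ {x} → x ∈ L → x ≤ n
  L-bounded x∈ with ∈-applyUpTo⁻ ω′ x∈
  ... | j , j<1+n , refl = ω′≤ (s≤s⁻¹ j<1+n)

  -- Vertex i+1 is car i+1: its parent is visited at position aᵢ - 1 and itself at
  -- position sᵢ, so the parking rule becomes the greedy rule of the search.
  L-prefix : SearchPrefix L
  L-prefix = record
    { root-first   = refl
    ; root∈        = here refl
    ; unique       = L-unique
    ; bounded      = L-bounded
    ; parent-first = parent-first
    ; greedy       = greedy
    }
    where
    parent-first : ∀ {x} → x ∈ L → x ≢ 0 → indexOf (parent τ′ x) L < indexOf x L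
    parent-first {zero}  _  0≢0 = contradiction refl 0≢0
    parent-first {suc i} x∈ _   with car-parks (L-bounded x∈)
    ... | (aᵢ≤sᵢ , _) , _ = subst₂ _<_ (sym (indexOf-parent (L-bounded x∈))) (sym (indexOf-car (L-bounded x∈)))
                                    (<-≤-trans (m≤pred[n]⇒suc[m]≤n {{>-nonZero (a≥1 (L-bounded x∈))}} ≤-refl) aᵢ≤sᵢ)
    greedy : ∀ {v j} → v ≢ 0 → v ≤ n → j < length L →
             indexOf (parent τ′ v) L < j → j < indexOf v L → nthD L j < v
    greedy {zero}          0≢0 = contradiction refl 0≢0
    greedy {suc i} {j} _ i<n _ p<j j<v with car-parks i<n
    ... | (_ , _ , occupied) , sᵢ≤n =
      subst (_< suc i) (sym (trans (nthD-L j≤n) (carAtSpot-suc S j≢0))) (s≤s (∈-take⇒indexOf< i S j∈))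
      where
      aᵢ≤j : nthD as i ≤ j
      aᵢ≤j = subst (_≤ j) (suc-pred (nthD as i) {{>-nonZero (a≥1 i<n)}}) (subst (_< j) (indexOf-parent i<n) p<j)
      j<sᵢ : j < nthD S i
      j<sᵢ = subst (j <_) (indexOf-car i<n) j<v
      j∈ : j ∈ take i S
      j∈ = occupied aᵢ≤j j<sᵢ
      j≤n : j ≤ n
      j≤n = ≤-trans (<⇒≤ j<sᵢ) sᵢ≤n
      j≢0 : j ≢ 0
      j≢0 = >⇒≢ (≤-trans (a≥1 i<n) aᵢ≤j)

  L-order : SearchOrder L
  L-order = record { prefix = L-prefix ; complete = L-length }

  wearyList-τ′ : wearyList τ′ ≡ L
  wearyList-τ′ = wearyList-unique L-order

  τ′-tree : IsTree τ′
  τ′-tree = record { label≤ = label≤ ; reachesRoot = λ _ v≤n → iter-parent-root n v≤n (pos≤ v≤n) }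
    where
    open SearchOrderProperties L-order
    label≤ : ∀ {x} → x ∈ toList τ′ → x ≤ n
    label≤ {x} x∈
      with ∈-map⁻ (ω′ ∘ pred) (subst (x ∈_) (Vec.toList-map (ω′ ∘ pred) π) (subst (λ σ → x ∈ toList σ) τ′≡ x∈))
    ... | a , a∈ , refl = ω′≤ (≤-trans pred[n]≤n (proj₂ (preference-bounds a∈)))

  prefSeq-τ′ : prefSeq τ′ ≡ π
  prefSeq-τ′ = begin
    Vec.map (λ p → suc (wearyInv τ′ p)) τ′
      ≡⟨ cong (Vec.map (λ p → suc (wearyInv τ′ p))) τ′≡ ⟩
    Vec.map (λ p → suc (wearyInv τ′ p)) (Vec.map (ω′ ∘ pred) π)
      ≡⟨ Vec.map-∘ (λ p → suc (wearyInv τ′ p)) (ω′ ∘ pred) π ⟨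
    Vec.map (λ a → suc (wearyInv τ′ (ω′ (pred a)))) π
      ≡⟨ Vec-map-id-local π suc-pos-ω′ ⟩
    π
      ∎
    where
    open ≡-Reasoning
    suc-pos-ω′ : ∀ {a} → a ∈ toList π → suc (wearyInv τ′ (ω′ (pred a))) ≡ a
    suc-pos-ω′ {a} a∈ with preference-bounds a∈
    ... | 1≤a , a≤n rewrite wearyList-τ′ | indexOf-ω′ (≤-trans pred[n]≤n a≤n) = suc-pred a {{>-nonZero 1≤a}}

-- Enumerations and weighted sums

allVecs-suc : ∀ m n → allVecs m (suc n) ≡ cartesianProductWith Vec._∷_ (upTo m) (allVecs m n)
allVecs-suc m n = concatMap≡cartesianProduct (upTo m)
  where
  concatMap≡cartesianProduct : ∀ xs → concatMap (λ x → map (x Vec.∷_) (allVecs m n)) xs ≡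
                                      cartesianProductWith Vec._∷_ xs (allVecs m n)
  concatMap≡cartesianProduct []       = refl
  concatMap≡cartesianProduct (x ∷ xs) = cong (map (x Vec.∷_) (allVecs m n) ++_) (concatMap≡cartesianProduct xs)

∈-allVecs : ∀ m {n} (v : Vec ℕ n) → (∀ {x} → x ∈ toList v → x < m) → v ∈ allVecs m n
∈-allVecs m Vec.[]                 _   = here refl
∈-allVecs m {suc n} (x Vec.∷ v) v<m = subst (_ ∈_) (sym (allVecs-suc m n))
  (∈-cartesianProductWith⁺ Vec._∷_ (∈-upTo⁺ (v<m (here refl))) (∈-allVecs m v (v<m ∘ there)))

allVecs-unique : ∀ m n → Unique (allVecs m n)
allVecs-unique m zero    = [] ∷ []
allVecs-unique m (suc n) = subst Unique (sym (allVecs-suc m n))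
  (Unique.cartesianProductWith⁺ Vec._∷_ Vec.∷-injective (Unique.upTo⁺ m) (allVecs-unique m n))

map-suc-injective : ∀ {n} {u v : Vec ℕ n} → Vec.map suc u ≡ Vec.map suc v → u ≡ v
map-suc-injective {u = u} {v} eq = trans (sym (pred∘suc u)) (trans (cong (Vec.map pred) eq) (pred∘suc v))
  where
  pred∘suc : ∀ {n} (x : Vec ℕ n) → Vec.map pred (Vec.map suc x) ≡ x
  pred∘suc x = trans (sym (Vec.map-∘ pred suc x)) (Vec.map-id x)

∈-kAryTrees⇔ : ∀ k n {τ} → τ ∈ kAryTrees k n ⇔ (IsTree τ × T (isKAry k τ))
∈-kAryTrees⇔ k n {τ} = mk⇔ to from
  where
  to : τ ∈ kAryTrees k n → IsTree τ × T (isKAry k τ)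
  to τ∈ with Equivalence.to T-∧
                (proj₂ (∈-filter⁻ (λ τ → T? (isCayleyTree τ ∧ isKAry k τ)) {xs = allVecs (suc n) n} τ∈))
  ... | cayley , kary = Equivalence.to (isCayleyTree⇔IsTree τ) cayley , kary
  from : IsTree τ × T (isKAry k τ) → τ ∈ kAryTrees k n
  from (tree , kary) = ∈-filter⁺ (λ τ → T? (isCayleyTree τ ∧ isKAry k τ))
    (∈-allVecs (suc n) τ (s≤s ∘ IsTree.label≤ tree))
    (Equivalence.from T-∧ (Equivalence.from (isCayleyTree⇔IsTree τ) tree , kary))

∈-pfLe⇔ : ∀ k n {π} → π ∈ pfLe k n ⇔ (T (isParkingFunction π) × T (atMost k π))
∈-pfLe⇔ k n {π} = mk⇔ to from
  where
  to : π ∈ pfLe k n → T (isParkingFunction π) × T (atMost k π)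
  to π∈ = Equivalence.to T-∧
    (proj₂ (∈-filter⁻ (λ π → T? (isParkingFunction π ∧ atMost k π)) {xs = map (Vec.map suc) (allVecs n n)} π∈))
  from : T (isParkingFunction π) × T (atMost k π) → π ∈ pfLe k n
  from (pf , ≤k) = ∈-filter⁺ (λ π → T? (isParkingFunction π ∧ atMost k π)) π∈ (Equivalence.from T-∧ (pf , ≤k))
    where
    bounds : IsPreference π
    bounds = proj₁ (Equivalence.to (isParkingFunction⇔ π) pf)
    suc∘pred : Vec.map suc (Vec.map pred π) ≡ π
    suc∘pred = trans (sym (Vec.map-∘ suc pred π))
                     (Vec-map-id-local π λ a∈ → suc-pred _ {{>-nonZero (proj₁ (bounds a∈))}})
    pred<n : ∀ {x} → x ∈ toList (Vec.map pred π) → x < n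
    pred<n x∈ with ∈-map⁻ pred (subst (_ ∈_) (Vec.toList-map pred π) x∈)
    ... | a , a∈ , refl with bounds a∈
    ...   | 1≤a , a≤n = subst (_≤ n) (sym (suc-pred a {{>-nonZero 1≤a}})) a≤n
    π∈ : π ∈ map (Vec.map suc) (allVecs n n)
    π∈ = subst (_∈ map (Vec.map suc) (allVecs n n)) suc∘pred
               (∈-map⁺ (Vec.map suc) (∈-allVecs n (Vec.map pred π) pred<n))

prefSeq-∈-pfLe : ∀ k n {τ} → τ ∈ kAryTrees k n → prefSeq τ ∈ pfLe k n
prefSeq-∈-pfLe k n τ∈ with Equivalence.to (∈-kAryTrees⇔ k n) τ∈
... | tree , kary = Equivalence.from (∈-pfLe⇔ k n) (π-isParkingFunction , Equivalence.to (isKAry⇔atMost k) kary)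
  where open TreeToParking tree

pfLe-tree : ∀ k n {π} → π ∈ pfLe k n → Σ (Vec ℕ n) (λ τ → τ ∈ kAryTrees k n × prefSeq τ ≡ π)
pfLe-tree k n {π} π∈ with Equivalence.to (∈-pfLe⇔ k n) π∈
... | pf , ≤k = τ′ , Equivalence.from (∈-kAryTrees⇔ k n) (τ′-tree , kary) , prefSeq-τ′
  where
  open ParkingToTree {π = π} pf
  open TreeToParking τ′-tree using (isKAry⇔atMost)
  kary : T (isKAry k τ′)
  kary = Equivalence.from (isKAry⇔atMost k) (subst (T ∘ atMost k) (sym prefSeq-τ′) ≤k)

record-duality : ∀ k n (π : Vec ℕ n) → Σ (Vec ℕ n) (λ τ → τ ∈ kAryTrees k n × prefSeq τ ≡ π) ⇔ π ∈ pfLe k n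
record-duality k n π = mk⇔ (λ { (τ , τ∈ , refl) → prefSeq-∈-pfLe k n τ∈ }) (pfLe-tree k n)

prefSeq-↭ : ∀ k n → map prefSeq (kAryTrees k n) ↭ pfLe k n
prefSeq-↭ k n = Unique-⇔⇒↭ prefSeqs-unique pfLe-unique (mk⇔ to from)
  where
  trees-unique : Unique (kAryTrees k n)
  trees-unique = Unique.filter⁺ _ (allVecs-unique (suc n) n)
  prefSeqs-unique : Unique (map prefSeq (kAryTrees k n))
  prefSeqs-unique = Unique.map⁻ {f = treeOf} (subst Unique (sym treeOf∘prefSeq) trees-unique)
    where
    treeOf-prefSeq : ∀ {τ} → τ ∈ kAryTrees k n → treeOf (prefSeq τ) ≡ τ
    treeOf-prefSeq τ∈ = TreeToParking.treeOf-π (proj₁ (Equivalence.to (∈-kAryTrees⇔ k n) τ∈))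
    treeOf∘prefSeq : map treeOf (map prefSeq (kAryTrees k n)) ≡ kAryTrees k n
    treeOf∘prefSeq = trans (sym (map-∘ _)) (map-id-local (All.tabulate treeOf-prefSeq))
  pfLe-unique : Unique (pfLe k n)
  pfLe-unique = Unique.filter⁺ _ (Unique.map⁺ map-suc-injective (allVecs-unique n n))
  to : ∀ {π} → π ∈ map prefSeq (kAryTrees k n) → π ∈ pfLe k n
  to π∈ with ∈-map⁻ prefSeq π∈
  ... | τ , τ∈ , refl = prefSeq-∈-pfLe k n τ∈
  from : ∀ {π} → π ∈ pfLe k n → π ∈ map prefSeq (kAryTrees k n)
  from π∈ with pfLe-tree k n π∈
  ... | τ , τ∈ , refl = ∈-map⁺ prefSeq τ∈

module WeightSums {c ℓ : Level} (R : CommutativeSemiring c ℓ) where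
  open CommutativeSemiring R
    using (Carrier; _≈_; _*_; setoid; isEquivalence; +-isCommutativeMonoid; rawSemiring)
  open Weights R
  open import Algebra.Definitions.RawSemiring rawSemiring using (_^_)
  import Data.List.Relation.Binary.Permutation.Setoid.Properties setoid as ↭ₛ

  sumR-↭ : ∀ {xs ys} → xs ↭ ys → sumR xs ≈ sumR ys
  sumR-↭ = ↭ₛ.foldr-commMonoid +-isCommutativeMonoid ∘ ↭⇒↭ₛ′ isEquivalence

  module _ (y z t q : Carrier) (w : ℕ → Carrier) where

    monomial : ℕ → ℕ → ℕ → List ℕ → ℕ → Carrier
    monomial a b c d e = (y ^ a) * (z ^ b) * (t ^ c) * wpow w d * (q ^ e)

    monomial-cong : ∀ {a a′ b b′ c c′ d d′} e → a ≡ a′ → b ≡ b′ → c ≡ c′ → d ≡ d′ →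
                    monomial a b c d e ≡ monomial a′ b′ c′ d′ e
    monomial-cong e refl refl refl refl = refl

    treeWeight≡pfWeight : ∀ {n} {τ : Vec ℕ n} → IsTree τ →
                          treeWeight y z t q w τ ≡ pfWeight y z t q w (prefSeq τ)
    treeWeight≡pfWeight {n} tree = monomial-cong n wait≡probes psa≡lucky degRoot≡ones chseq≡mult
      where open TreeToParking tree

    sum-treeWeight≈sum-pfWeight : ∀ k n → sumR (map (treeWeight y z t q w) (kAryTrees k n)) ≈
                                          sumR (map (pfWeight y z t q w) (pfLe k n))
    sum-treeWeight≈sum-pfWeight k n = begin
      sumR (map (treeWeight y z t q w) (kAryTrees k n))
        ≡⟨ cong sumR (map-cong-local (All.tabulate λ τ∈ → treeWeight≡pfWeight (tree τ∈))) ⟩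
      sumR (map (pfWeight y z t q w ∘ prefSeq) (kAryTrees k n))
        ≡⟨ cong sumR (map-∘ (kAryTrees k n)) ⟩
      sumR (map (pfWeight y z t q w) (map prefSeq (kAryTrees k n)))
        ≈⟨ sumR-↭ (map⁺ (pfWeight y z t q w) (prefSeq-↭ k n)) ⟩
      sumR (map (pfWeight y z t q w) (pfLe k n))
        ∎
      where
      open import Relation.Binary.Reasoning.Setoid setoid
      tree : ∀ {τ} → τ ∈ kAryTrees k n → IsTree τ
      tree = proj₁ ∘ Equivalence.to (∈-kAryTrees⇔ k n)

corollary4p6 : {c ℓ : Level} (k : ℕ) → 1 ≤ k →
    ((n : ℕ) → (π : Vec ℕ n) →
      (Σ (Vec ℕ n) (λ T → T ∈ kAryTrees k n × prefSeq T ≡ π)) ⇔ (π ∈ pfLe k n))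
    ×
    ((R : CommutativeSemiring c ℓ) →
      (y z t q : CommutativeSemiring.Carrier R)
      (w : ℕ → CommutativeSemiring.Carrier R) (n : ℕ) →
      CommutativeSemiring._≈_ R
        (Weights.sumR R (map (Weights.treeWeight R y z t q w) (kAryTrees k n)))
        (Weights.sumR R (map (Weights.pfWeight R y z t q w) (pfLe k n))))
corollary4p6 k _ =
  record-duality k ,
  λ R y z t q w → WeightSums.sum-treeWeight≈sum-pfWeight R y z t q w k
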